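{- Let $n\ge4$ and $k\ge1$ be integers. Then \[ \gamma_{[k]R}(C_7\Box P_n)\le 7(n-2)\left\lceil\frac{k+5}{5}\right\rceil+14\left\lceil\frac{k+3-\left\lceil\frac{k+5}{5}\right\rceil}{3}\right\rceil-(n+2). \]
   Context: For a graph $G$ and $v\in V(G)$, $N(v)$ is the open neighborhood and $N[v]=N(v)\cup\{v\}$. For an integer $k\ge1$, a function $f:V(G)\to\{0,1,\dots,k+1\}$ is a $[k]$-Roman dominating function if for every vertex $v$ with $f(v)<k$ we have $\sum_{u\in N[v]}f(u)\ge k+|\{u\in N(v): f(u)>0\}|$. The weight of $f$ is $\sum_{v}f(v)$, and $\gamma_{[k]R}(G)$ is the minimum weight of a $[k]$-Roman dominating function on $G$. $C_m\Box P_n$ is the Cartesian product of the cycle $C_m$ (vertices $0,\dots,m-1$ mod $m$) and the path $P_n$ (vertices $0,\dots,n-1$): $(i,j)\sim(i',j')$ iff ($i=i'$ and $|j-j'|=1$) or ($j=j'$ and $i'\equiv i\pm1 \pmod m$). -}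

module Defs where

open import Data.Nat using (ℕ; zero; suc; _+_; _*_; _∸_; _≤_; _<_; _≡ᵇ_; NonZero; _/_)
open import Data.Nat.DivMod
open import Data.Bool using (Bool; true; false; _∧_; _∨_; if_then_else_)
open import Data.Fin using (Fin; toℕ) renaming (zero to fzero; suc to fsuc)
open import Data.Fin.Properties using () renaming (_≟_ to _≟ᶠ_)
open import Data.Product using (_×_; _,_; Σ)
open import Relation.Nullary.Decidable using (⌊_⌋)

⌈_/_⌉ : ℕ → (b : ℕ) → .{{NonZero b}} → ℕ
⌈ a / b ⌉ = (a + b ∸ 1) / b

sumFin : (n : ℕ) → (Fin n → ℕ) → ℕ
sumFin zero g = 0
sumFin (suc n) g = g fzero + sumFin n (λ i → g (fsuc i))

-- vertices of C_m □ P_n : pairs (i , j), i ∈ Z_m (cycle), j ∈ {0..n-1} (path)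
Vertex : ℕ → ℕ → Set
Vertex m n = Fin m × Fin n

sumV : (m n : ℕ) → (Vertex m n → ℕ) → ℕ
sumV m n g = sumFin m (λ i → sumFin n (λ j → g (i , j)))

adjC : (m : ℕ) → Fin m → Fin m → Bool
adjC m i i' = ((toℕ i' ≡ᵇ ((suc (toℕ i)) % suc m')) ∨ (toℕ i ≡ᵇ ((suc (toℕ i')) % suc m')))
  where
  m' : ℕ
  m' = m ∸ 1

adjP : (n : ℕ) → Fin n → Fin n → Bool
adjP n j j' = (toℕ j' ≡ᵇ suc (toℕ j)) ∨ (toℕ j ≡ᵇ suc (toℕ j'))

adj : (m n : ℕ) → Vertex m n → Vertex m n → Bool
adj m n (i , j) (i' , j') = (⌊ i ≟ᶠ i' ⌋ ∧ adjP n j j') ∨ (⌊ j ≟ᶠ j' ⌋ ∧ adjC m i i')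

isPos : ℕ → Bool
isPos zero = false
isPos (suc _) = true

nbrSum : (m n : ℕ) → (Vertex m n → ℕ) → Vertex m n → ℕ
nbrSum m n f v = sumV m n (λ u → if adj m n v u then f u else 0)

nbrPos : (m n : ℕ) → (Vertex m n → ℕ) → Vertex m n → ℕ
nbrPos m n f v = sumV m n (λ u → if adj m n v u ∧ isPos (f u) then 1 else 0)

IsKRDF : (k m n : ℕ) → (Vertex m n → ℕ) → Set
IsKRDF k m n f =
  ((v : Vertex m n) → f v ≤ suc k) ×
  ((v : Vertex m n) → f v < k → k + nbrPos m n f v ≤ f v + nbrSum m n f v)

weight : (m n : ℕ) → (Vertex m n → ℕ) → ℕ
weight m n f = sumV m n f

-- γ_{[k]R}(C_m □ P_n) ≤ B  (γ is the minimum weight, so this holds iff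
-- some [k]-RDF has weight ≤ B)
γ[_]R-C_□P_≤_ : (k m n B : ℕ) → Set
γ[ k ]R-C m □P n ≤ B = Σ (Vertex m n → ℕ) (λ f → IsKRDF k m n f × weight m n f ≤ B)

-- A labelling of C₇ □ Pₙ is handled column by column (a column being one copy of C₇), and the
-- [k]-Roman condition at a vertex only involves its own column and the two adjacent ones.
-- For each k ≤ 35 an explicit certificate (a prefix, a periodically repeated block of columns
-- and a suffix, plus explicit labellings for small n) yields labellings within the bound for
-- every n ≥ 4; checking it is a finite computation over windows of three consecutive columns.
-- For k ≥ 36 write k ≡ k′ (mod 15) with 21 ≤ k′ ≤ 35, where the certified labellings are
-- positive and satisfy the domination inequality at every vertex. Adding 3 to every vertex,
-- and 4 on the two end columns, preserves this while raising k by 15: every closed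
-- neighbourhood gains at least 15, and the weight grows by 7(3n + 2), exactly as the bound does.

module Submission where

open import Defs
open import Data.Nat using (ℕ; zero; suc; _+_; _*_; _∸_; _≤_; _<_; _≡ᵇ_; z≤n; s≤s; z<s; s<s; NonZero; _/_)
open import Data.Nat.Properties
open import Data.Nat.DivMod using (m%n<n; +-distrib-/-∣ʳ; m*n/n≡m; m<n*o⇒m/o<n)
open import Data.Nat.Divisibility using (n∣m*n)
open import Data.Nat.Induction using (<-rec)
open import Data.Nat.ListAction using () renaming (sum to sumᴸ)
open import Data.Nat.ListAction.Properties using () renaming (sum-++ to sumᴸ-++)
open import Data.Nat.Solver using (module +-*-Solver)
open import Data.Bool using (Bool; true; false; _∧_; _∨_; if_then_else_)
open import Data.Bool.Properties using (∧-zeroʳ; ∧-comm) renaming (_≟_ to _≟ᵇ_)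
open import Data.Fin using (Fin; toℕ; fromℕ<) renaming (zero to fzero; suc to fsuc)
open import Data.Fin.Properties using (all?; toℕ<n; toℕ-fromℕ<) renaming (_≟_ to _≟ᶠ_)
open import Data.List using (List; []; _∷_; _++_; length; head)
import Data.List as List
open import Data.List.Properties using (length-++; map-++)
open import Data.Vec using (Vec; []; _∷_; lookup)
open import Data.Maybe using (Maybe; just; nothing; map; maybe′; _<∣>_)
open import Data.Maybe.Properties using (maybe′-map)
open import Data.Maybe.Relation.Unary.All as All using (All; just; nothing)
open import Data.Maybe.Relation.Unary.All.Properties using (map⁺)
open import Data.Product using (_×_; _,_; proj₁; proj₂)
open import Data.Unit using (⊤; tt)
open import Function using (_∘_; id)
open import Relation.Nullary using (Dec; yes; no; ¬?; contradiction)
open import Relation.Nullary.Decidable using (⌊_⌋; _×-dec_; _→-dec_; from-yes)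
open import Relation.Binary.PropositionalEquality
open import Algebra.Properties.CommutativeSemigroup +-commutativeSemigroup using (interchange; xy∙z≈xz∙y)
open import Algebra.Properties.Semiring.Sum +-*-semiring
  using (sum; sum-syntax; sum-cong-≗; sum-replicate-zero; ∑-distrib-+; ∑-comm; *-distribˡ-sum)
open +-*-Solver using (solve; _:+_; _:*_; _:=_; con)

-- Finite sums

sumFin≡sum : ∀ n (g : Fin n → ℕ) → sumFin n g ≡ sum g
sumFin≡sum zero    g = refl
sumFin≡sum (suc n) g = cong (g fzero +_) (sumFin≡sum n (g ∘ fsuc))

sumV≡∑∑ : ∀ m n (g : Vertex m n → ℕ) → sumV m n g ≡ ∑[ i < m ] ∑[ j < n ] g (i , j)
sumV≡∑∑ m n g = trans (sumFin≡sum m _) (sum-cong-≗ {m} (λ i → sumFin≡sum n _))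

∑-δ : ∀ {n} (j : Fin n) (g : Fin n → ℕ) → ∑[ j′ < n ] (if ⌊ j ≟ᶠ j′ ⌋ then g j′ else 0) ≡ g j
∑-δ {suc n} fzero    g = trans (cong (g fzero +_) (sum-replicate-zero n)) (+-identityʳ _)
∑-δ {suc n} (fsuc j) g =
  trans (sum-cong-≗ λ j′ → cong (λ b → if b then g (fsuc j′) else 0) (⌊suc≟suc⌋ j j′)) (∑-δ j (g ∘ fsuc))
  where
  -- ⌊_⌋ does not compute through the map′ in fsuc j ≟ fsuc j′.
  ⌊suc≟suc⌋ : ∀ {n} (j j′ : Fin n) → ⌊ fsuc j ≟ᶠ fsuc j′ ⌋ ≡ ⌊ j ≟ᶠ j′ ⌋
  ⌊suc≟suc⌋ j j′ with j ≟ᶠ j′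
  ... | yes _ = refl
  ... | no _  = refl

if-∨ : ∀ a b x → a ∧ b ≡ false → (if a ∨ b then x else 0) ≡ (if a then x else 0) + (if b then x else 0)
if-∨ true  false x _ = sym (+-identityʳ x)
if-∨ false b     x _ = refl

∑-δ₂ : ∀ {n} {a b : Fin n} → a ≢ b → (g : Fin n → ℕ) →
       ∑[ j < n ] (if ⌊ a ≟ᶠ j ⌋ ∨ ⌊ b ≟ᶠ j ⌋ then g j else 0) ≡ g a + g b
∑-δ₂ {n} {a} {b} a≢b g = begin
  ∑[ j < n ] (if ⌊ a ≟ᶠ j ⌋ ∨ ⌊ b ≟ᶠ j ⌋ then g j else 0)
    ≡⟨ sum-cong-≗ {n} (λ j → if-∨ ⌊ a ≟ᶠ j ⌋ ⌊ b ≟ᶠ j ⌋ (g j) (exclusive j)) ⟩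
  ∑[ j < n ] ((if ⌊ a ≟ᶠ j ⌋ then g j else 0) + (if ⌊ b ≟ᶠ j ⌋ then g j else 0))
    ≡⟨ ∑-distrib-+ {n} _ _ ⟩
  ∑[ j < n ] (if ⌊ a ≟ᶠ j ⌋ then g j else 0) + ∑[ j < n ] (if ⌊ b ≟ᶠ j ⌋ then g j else 0)
    ≡⟨ cong₂ _+_ (∑-δ a g) (∑-δ b g) ⟩
  g a + g b ∎
  where
  open ≡-Reasoning
  exclusive : ∀ j → ⌊ a ≟ᶠ j ⌋ ∧ ⌊ b ≟ᶠ j ⌋ ≡ false
  exclusive j with a ≟ᶠ j | b ≟ᶠ j
  ... | yes refl | yes refl = contradiction refl a≢b
  ... | yes _    | no _     = refl
  ... | no _     | _        = refl

if-∧ : ∀ a b (x : ℕ) → (if a ∧ b then x else 0) ≡ (if a then (if b then x else 0) else 0)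
if-∧ true  b x = refl
if-∧ false b x = refl

∑-if-∧ˡ : ∀ n a (b : Fin n → Bool) (g : Fin n → ℕ) →
          ∑[ j < n ] (if a ∧ b j then g j else 0) ≡ (if a then ∑[ j < n ] (if b j then g j else 0) else 0)
∑-if-∧ˡ n true  b g = refl
∑-if-∧ˡ n false b g = sum-replicate-zero n

∑-if-∧ʳ : ∀ n a (b : Fin n → Bool) (g : Fin n → ℕ) →
          ∑[ j < n ] (if b j ∧ a then g j else 0) ≡ (if a then ∑[ j < n ] (if b j then g j else 0) else 0)
∑-if-∧ʳ n a b g =
  trans (sum-cong-≗ {n} λ j → cong (λ c → if c then g j else 0) (∧-comm (b j) a)) (∑-if-∧ˡ n a b g)

-- Neighbourhoods in C₇ □ Pₙ

cycleSuc cyclePred : ∀ {m} → Fin (suc m) → Fin (suc m)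
cycleSuc  {m} i = fromℕ< (m%n<n (suc (toℕ i)) (suc m))
cyclePred {m} i = fromℕ< (m%n<n (toℕ i + m) (suc m))

adjC₇-irrefl : ∀ i → adjC 7 i i ≡ false
adjC₇-irrefl = from-yes (all? λ i → adjC 7 i i ≟ᵇ false)

adjC₇-cycle : ∀ i i′ → adjC 7 i i′ ≡ ⌊ cycleSuc i ≟ᶠ i′ ⌋ ∨ ⌊ cyclePred i ≟ᶠ i′ ⌋
adjC₇-cycle = from-yes (all? λ i → all? λ i′ → adjC 7 i i′ ≟ᵇ (⌊ cycleSuc i ≟ᶠ i′ ⌋ ∨ ⌊ cyclePred i ≟ᶠ i′ ⌋))

cycleSuc₇≢cyclePred₇ : ∀ (i : Fin 7) → cycleSuc i ≢ cyclePred i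
cycleSuc₇≢cyclePred₇ = from-yes (all? λ (i : Fin 7) → ¬? (cycleSuc i ≟ᶠ cyclePred i))

∑-adjC₇ : ∀ i (g : Fin 7 → ℕ) → ∑[ i′ < 7 ] (if adjC 7 i i′ then g i′ else 0) ≡ g (cycleSuc i) + g (cyclePred i)
∑-adjC₇ i g = trans (sum-cong-≗ {7} λ i′ → cong (λ b → if b then g i′ else 0) (adjC₇-cycle i i′))
                    (∑-δ₂ (cycleSuc₇≢cyclePred₇ i) g)

pathPred : ℕ → Maybe ℕ
pathPred zero    = nothing
pathPred (suc t) = just t

-- The (suc n) (suc t) clause comes first so that it reduces for a variable n.
pathSucc : ℕ → ℕ → Maybe ℕ
pathSucc (suc n)       (suc t) = map suc (pathSucc n t)
pathSucc (suc (suc n)) zero    = just 1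
pathSucc _             _       = nothing

∑-adjP : ∀ {n} (j : Fin n) (G : ℕ → ℕ) →
         ∑[ j′ < n ] (if adjP n j j′ then G (toℕ j′) else 0) ≡
         maybe′ G 0 (pathPred (toℕ j)) + maybe′ G 0 (pathSucc n (toℕ j))
∑-adjP {suc n} fzero G = neighbourOf0 n
  where
  neighbourOf0 : ∀ n → ∑[ j′ < n ] (if (toℕ j′ ≡ᵇ 0) ∨ false then G (suc (toℕ j′)) else 0) ≡
                       maybe′ G 0 (pathSucc (suc n) 0)
  neighbourOf0 zero    = refl
  neighbourOf0 (suc n) = trans (cong (G 1 +_) (sum-replicate-zero n)) (+-identityʳ _)
∑-adjP {suc n} (fsuc j) G = begin
  g₀ + ∑[ j′ < n ] (if adjP n j j′ then G (suc (toℕ j′)) else 0)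
    ≡⟨ cong (g₀ +_) (∑-adjP j (G ∘ suc)) ⟩
  g₀ + (maybe′ (G ∘ suc) 0 (pathPred (toℕ j)) + maybe′ (G ∘ suc) 0 (pathSucc n (toℕ j)))
    ≡⟨ sym (+-assoc g₀ _ _) ⟩
  g₀ + maybe′ (G ∘ suc) 0 (pathPred (toℕ j)) + maybe′ (G ∘ suc) 0 (pathSucc n (toℕ j))
    ≡⟨ cong₂ _+_ (predecessor j) (sym (maybe′-map G 0 suc (pathSucc n (toℕ j)))) ⟩
  G (toℕ j) + maybe′ G 0 (map suc (pathSucc n (toℕ j))) ∎
  where
  open ≡-Reasoning
  g₀ : ℕ
  g₀ = if toℕ j ≡ᵇ 0 then G 0 else 0
  predecessor : ∀ {n} (j : Fin n) →
                (if toℕ j ≡ᵇ 0 then G 0 else 0) + maybe′ (G ∘ suc) 0 (pathPred (toℕ j)) ≡ G (toℕ j)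
  predecessor fzero    = +-identityʳ _
  predecessor (fsuc j) = refl

nbrSum₇-split : ∀ n (f : Vertex 7 n → ℕ) (i : Fin 7) (j : Fin n) →
                nbrSum 7 n f (i , j) ≡
                ∑[ j′ < n ] (if adjP n j j′ then f (i , j′) else 0) + (f (cycleSuc i , j) + f (cyclePred i , j))
nbrSum₇-split n f i j = begin
  nbrSum 7 n f (i , j)
    ≡⟨ sumV≡∑∑ 7 n (λ u → if adj 7 n (i , j) u then f u else 0) ⟩
  ∑[ i′ < 7 ] ∑[ j′ < n ] (if adj 7 n (i , j) (i′ , j′) then f (i′ , j′) else 0)
    ≡⟨ sum-cong-≗ {7} (λ i′ → sum-cong-≗ {n} λ j′ →
         if-∨ (⌊ i ≟ᶠ i′ ⌋ ∧ adjP n j j′) (⌊ j ≟ᶠ j′ ⌋ ∧ adjC 7 i i′) (f (i′ , j′)) (exclusive i′ j′)) ⟩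
  ∑[ i′ < 7 ] ∑[ j′ < n ] (pathTerm i′ j′ + cycleTerm i′ j′)
    ≡⟨ sum-cong-≗ {7} (λ i′ → ∑-distrib-+ {n} (pathTerm i′) (cycleTerm i′)) ⟩
  ∑[ i′ < 7 ] (∑[ j′ < n ] pathTerm i′ j′ + ∑[ j′ < n ] cycleTerm i′ j′)
    ≡⟨ ∑-distrib-+ {7} (λ i′ → ∑[ j′ < n ] pathTerm i′ j′) (λ i′ → ∑[ j′ < n ] cycleTerm i′ j′) ⟩
  ∑[ i′ < 7 ] ∑[ j′ < n ] pathTerm i′ j′ + ∑[ i′ < 7 ] ∑[ j′ < n ] cycleTerm i′ j′
    ≡⟨ cong₂ _+_ pathPart cyclePart ⟩
  ∑[ j′ < n ] (if adjP n j j′ then f (i , j′) else 0) + (f (cycleSuc i , j) + f (cyclePred i , j)) ∎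
  where
  open ≡-Reasoning
  pathTerm cycleTerm : Fin 7 → Fin n → ℕ
  pathTerm  i′ j′ = if ⌊ i ≟ᶠ i′ ⌋ ∧ adjP n j j′ then f (i′ , j′) else 0
  cycleTerm i′ j′ = if ⌊ j ≟ᶠ j′ ⌋ ∧ adjC 7 i i′ then f (i′ , j′) else 0
  exclusive : ∀ i′ j′ → (⌊ i ≟ᶠ i′ ⌋ ∧ adjP n j j′) ∧ (⌊ j ≟ᶠ j′ ⌋ ∧ adjC 7 i i′) ≡ false
  exclusive i′ j′ with i ≟ᶠ i′
  ... | yes refl rewrite adjC₇-irrefl i | ∧-zeroʳ ⌊ j ≟ᶠ j′ ⌋ = ∧-zeroʳ (adjP n j j′)
  ... | no _ = refl
  pathPart : ∑[ i′ < 7 ] ∑[ j′ < n ] pathTerm i′ j′ ≡ ∑[ j′ < n ] (if adjP n j j′ then f (i , j′) else 0)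
  pathPart = trans (sum-cong-≗ {7} λ i′ → ∑-if-∧ˡ n ⌊ i ≟ᶠ i′ ⌋ (adjP n j) (λ j′ → f (i′ , j′)))
                   (∑-δ i (λ i′ → ∑[ j′ < n ] (if adjP n j j′ then f (i′ , j′) else 0)))
  cyclePart : ∑[ i′ < 7 ] ∑[ j′ < n ] cycleTerm i′ j′ ≡ f (cycleSuc i , j) + f (cyclePred i , j)
  cyclePart = trans (sum-cong-≗ {7} λ i′ →
                      trans (∑-if-∧ʳ n (adjC 7 i i′) (λ j′ → ⌊ j ≟ᶠ j′ ⌋) (λ j′ → f (i′ , j′)))
                            (cong (λ x → if adjC 7 i i′ then x else 0) (∑-δ j (λ j′ → f (i′ , j′)))))
                    (∑-adjC₇ i (λ i′ → f (i′ , j)))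

-- Labellings as sequences of columns

Col : Set
Col = Fin 7 → ℕ

labelling : ∀ {n} → (ℕ → Col) → Vertex 7 n → ℕ
labelling F (i , j) = F (toℕ j) i

above : (ℕ → Col) → ℕ → Maybe Col
above F t = map F (pathPred t)

below : ℕ → (ℕ → Col) → ℕ → Maybe Col
below n F t = map F (pathSucc n t)

entry : Maybe Col → Fin 7 → ℕ
entry a i = maybe′ (λ c → c i) 0 a

-- h = id gives the neighbourhood sum, h = sgn the number of positive neighbours.
nbrSumʷ : (ℕ → ℕ) → Maybe Col → Col → Maybe Col → Fin 7 → ℕ
nbrSumʷ h a c b i = h (entry a i) + h (entry b i) + (h (c (cycleSuc i)) + h (c (cyclePred i)))

nbrSumᶜ : (ℕ → ℕ) → ℕ → (ℕ → Col) → ℕ → Fin 7 → ℕ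
nbrSumᶜ h n F t = nbrSumʷ h (above F t) (F t) (below n F t)

nbrSum-labelling : ∀ n (h : ℕ → ℕ) → h 0 ≡ 0 → (F : ℕ → Col) (i : Fin 7) (j : Fin n) →
                   nbrSum 7 n (h ∘ labelling F) (i , j) ≡ nbrSumᶜ h n F (toℕ j) i
nbrSum-labelling n h h0≡0 F i j =
  trans (nbrSum₇-split n (h ∘ labelling F) i j)
        (cong (_+ (h (F (toℕ j) (cycleSuc i)) + h (F (toℕ j) (cyclePred i))))
              (trans (∑-adjP j (λ t → h (F t i)))
                     (cong₂ _+_ (entry-h (pathPred (toℕ j))) (entry-h (pathSucc n (toℕ j))))))
  where
  entry-h : ∀ m → maybe′ (λ t → h (F t i)) 0 m ≡ h (entry (map F m) i)
  entry-h nothing  = sym h0≡0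
  entry-h (just t) = refl

sgn : ℕ → ℕ
sgn x = if isPos x then 1 else 0

nbrPos≡nbrSum-sgn : ∀ m n (f : Vertex m n → ℕ) v → nbrPos m n f v ≡ nbrSum m n (sgn ∘ f) v
nbrPos≡nbrSum-sgn m n f v = begin
  nbrPos m n f v
    ≡⟨ sumV≡∑∑ m n _ ⟩
  ∑[ i < m ] ∑[ j < n ] (if adj m n v (i , j) ∧ isPos (f (i , j)) then 1 else 0)
    ≡⟨ sum-cong-≗ {m} (λ i → sum-cong-≗ {n} λ j → if-∧ (adj m n v (i , j)) (isPos (f (i , j))) 1) ⟩
  ∑[ i < m ] ∑[ j < n ] (if adj m n v (i , j) then sgn (f (i , j)) else 0)
    ≡⟨ sumV≡∑∑ m n _ ⟨
  nbrSum m n (sgn ∘ f) v ∎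
  where open ≡-Reasoning

WindowPredicate : Set₁
WindowPredicate = Maybe Col → Col → Maybe Col → Set

AllWindows : WindowPredicate → ℕ → (ℕ → Col) → Set
AllWindows W n F = ∀ t → t < n → W (above F t) (F t) (below n F t)

RomanWindow : ℕ → WindowPredicate
RomanWindow k a c b = ∀ i → c i ≤ suc k × (c i < k → k + nbrSumʷ sgn a c b i ≤ c i + nbrSumʷ id a c b i)

roman-labelling : ∀ {k n F} → AllWindows (RomanWindow k) n F → IsKRDF k 7 n (labelling F)
roman-labelling {k} {n} {F} roman = bounded , dominated
  where
  bounded : ∀ v → labelling F v ≤ suc k
  bounded (i , j) = proj₁ (roman (toℕ j) (toℕ<n j) i)
  dominated : ∀ v → labelling F v < k → k + nbrPos 7 n (labelling F) v ≤ labelling F v + nbrSum 7 n (labelling F) v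
  dominated (i , j) small =
    subst₂ (λ x y → k + x ≤ labelling F (i , j) + y)
           (sym (trans (nbrPos≡nbrSum-sgn 7 n (labelling F) (i , j)) (nbrSum-labelling n sgn refl F i j)))
           (sym (nbrSum-labelling n id refl F i j))
           (proj₂ (roman (toℕ j) (toℕ<n j) i) small)

colSum : Col → ℕ
colSum c = ∑[ i < 7 ] c i

columnsWeight : ℕ → (ℕ → Col) → ℕ
columnsWeight n F = ∑[ j < n ] colSum (F (toℕ j))

weight-labelling : ∀ n F → weight 7 n (labelling F) ≡ columnsWeight n F
weight-labelling n F = trans (sumV≡∑∑ 7 n (labelling F)) (∑-comm {7} {n} (λ i j → F (toℕ j) i))

α β : ℕ → ℕ
α k = ⌈ k + 5 / 5 ⌉
β k = ⌈ k + 3 ∸ α k / 3 ⌉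

bound : ℕ → ℕ → ℕ
bound k n = 7 * (n ∸ 2) * α k + 14 * β k

record Solution (W : ℕ → WindowPredicate) (k n : ℕ) : Set where
  field
    columns : ℕ → Col
    windows : AllWindows (W k) n columns
    light   : columnsWeight n columns + (n + 2) ≤ bound k n

solution⇒γ≤ : ∀ {k n} → Solution RomanWindow k n → γ[ k ]R-C 7 □P n ≤ (bound k n ∸ (n + 2))
solution⇒γ≤ {k} {n} s = labelling columns , roman-labelling windows ,
                        subst (_≤ bound k n ∸ (n + 2)) (sym (weight-labelling n columns)) (m+n≤o⇒m≤o∸n _ light)
  where open Solution s

-- Strongly dominating labellings and the step from k to k + 15

present : ∀ {A : Set} → Maybe A → ℕ
present nothing  = 0
present (just _) = 1

present-map : ∀ {A B : Set} (f : A → B) m → present (map f m) ≡ present m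
present-map f nothing  = refl
present-map f (just _) = refl

-- The form of the domination condition that survives adding a boost (strong-⊕).
StrongWindow : ℕ → WindowPredicate
StrongWindow k a c b = ∀ i → 1 ≤ c i × c i ≤ suc k × k + (present a + present b + 2) ≤ c i + nbrSumʷ id a c b i

pathPred-< : ∀ {n t} → t < n → All (_< n) (pathPred t)
pathPred-< {t = zero}  _   = nothing
pathPred-< {t = suc t} t<n = just (<-trans (n<1+n t) t<n)

pathSucc-< : ∀ n t → All (_< n) (pathSucc n t)
pathSucc-< (suc n)       (suc t) = map⁺ (All.map s<s (pathSucc-< n t))
pathSucc-< (suc (suc n)) zero    = just (s<s z<s)
pathSucc-< zero          _       = nothing
pathSucc-< (suc zero)    zero    = nothing

sgn-positive : ∀ {x} → 1 ≤ x → sgn x ≡ 1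
sgn-positive (s≤s _) = refl

sgn-entry : ∀ {F : ℕ → Col} {m} → All (λ s → ∀ i → 1 ≤ F s i) m →
            ∀ i → sgn (entry (map F m) i) ≡ present (map F m)
sgn-entry nothing      i = refl
sgn-entry (just pos) i = sgn-positive (pos i)

strong⇒roman : ∀ {k n F} → AllWindows (StrongWindow k) n F → AllWindows (RomanWindow k) n F
strong⇒roman {k} {n} {F} strong t t<n i with strong t t<n i
... | _ , bounded , dominated =
  bounded , λ _ → subst (λ x → k + x ≤ F t i + nbrSumᶜ id n F t i) (sym count) dominated
  where
  positive : ∀ s → s < n → ∀ i → 1 ≤ F s i
  positive s s<n = proj₁ ∘ strong s s<n
  count : nbrSumᶜ sgn n F t i ≡ present (above F t) + present (below n F t) + 2
  count = cong₂ _+_ (cong₂ _+_ (sgn-entry (All.map (positive _) (pathPred-< t<n)) i)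
                               (sgn-entry (All.map (positive _) (pathSucc-< n t)) i))
                    (cong₂ _+_ (sgn-positive (positive t t<n _)) (sgn-positive (positive t t<n _)))

BoostWindow : ℕ → WindowPredicate
BoostWindow d a c b = ∀ i → c i ≤ d × d ≤ c i + nbrSumʷ id a c b i

infixl 6 _⊕_
_⊕_ : (ℕ → Col) → (ℕ → Col) → (ℕ → Col)
(F ⊕ G) t i = F t i + G t i

nbrSumᶜ-⊕ : ∀ n (F G : ℕ → Col) t i → nbrSumᶜ id n (F ⊕ G) t i ≡ nbrSumᶜ id n F t i + nbrSumᶜ id n G t i
nbrSumᶜ-⊕ n F G t i = begin
  nbrSumᶜ id n (F ⊕ G) t i
    ≡⟨ cong (_+ ((F ⊕ G) t (cycleSuc i) + (F ⊕ G) t (cyclePred i)))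
            (cong₂ _+_ (entry-⊕ (pathPred t)) (entry-⊕ (pathSucc n t))) ⟩
  (a + a′) + (b + b′) + ((F t (cycleSuc i) + G t (cycleSuc i)) + (F t (cyclePred i) + G t (cyclePred i)))
    ≡⟨ cong₂ _+_ (interchange a a′ b b′) (interchange (F t (cycleSuc i)) _ (F t (cyclePred i)) _) ⟩
  (a + b) + (a′ + b′) + ((F t (cycleSuc i) + F t (cyclePred i)) + (G t (cycleSuc i) + G t (cyclePred i)))
    ≡⟨ interchange (a + b) _ _ _ ⟩
  nbrSumᶜ id n F t i + nbrSumᶜ id n G t i ∎
  where
  open ≡-Reasoning
  entry-⊕ : ∀ m → entry (map (F ⊕ G) m) i ≡ entry (map F m) i + entry (map G m) i
  entry-⊕ nothing  = refl
  entry-⊕ (just s) = refl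
  a a′ b b′ : ℕ
  a  = entry (above F t) i
  a′ = entry (above G t) i
  b  = entry (below n F t) i
  b′ = entry (below n G t) i

strong-⊕ : ∀ {k d n F G} → AllWindows (StrongWindow k) n F → AllWindows (BoostWindow d) n G →
           AllWindows (StrongWindow (k + d)) n (F ⊕ G)
strong-⊕ {k} {d} {n} {F} {G} strong boost t t<n i with strong t t<n i | boost t t<n i
... | F-pos , F-bounded , F-dominated | G-bounded , G-dominated =
  ≤-trans F-pos (m≤m+n _ _) , +-mono-≤ F-bounded G-bounded , dominated
  where
  open ≤-Reasoning
  degree : ℕ
  degree = present (pathPred t) + present (pathSucc n t) + 2
  presence : ∀ (H : ℕ → Col) → present (above H t) + present (below n H t) + 2 ≡ degree
  presence H = cong₂ (λ x y → x + y + 2) (present-map H (pathPred t)) (present-map H (pathSucc n t))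
  dominated : k + d + (present (above (F ⊕ G) t) + present (below n (F ⊕ G) t) + 2) ≤
              (F ⊕ G) t i + nbrSumᶜ id n (F ⊕ G) t i
  dominated = begin
    k + d + (present (above (F ⊕ G) t) + present (below n (F ⊕ G) t) + 2)
      ≡⟨ cong (k + d +_) (presence (F ⊕ G)) ⟩
    k + d + degree
      ≡⟨ xy∙z≈xz∙y k d degree ⟩
    k + degree + d
      ≡⟨ cong (λ x → k + x + d) (presence F) ⟨
    k + (present (above F t) + present (below n F t) + 2) + d
      ≤⟨ +-mono-≤ F-dominated G-dominated ⟩
    (F t i + nbrSumᶜ id n F t i) + (G t i + nbrSumᶜ id n G t i)
      ≡⟨ interchange (F t i) _ (G t i) _ ⟩
    (F t i + G t i) + (nbrSumᶜ id n F t i + nbrSumᶜ id n G t i)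
      ≡⟨ cong ((F t i + G t i) +_) (nbrSumᶜ-⊕ n F G t i) ⟨
    (F ⊕ G) t i + nbrSumᶜ id n (F ⊕ G) t i ∎

missing : Maybe ℕ → ℕ
missing m = 1 ∸ present m

-- 3 plus one for each missing path neighbour: every closed neighbourhood then receives at
-- least 15, and the total weight 7(3n + 2) is exactly the growth of bound from k to k + 15.
boost15 : ℕ → ℕ → Col
boost15 n t _ = 3 + missing (pathPred t) + missing (pathSucc n t)

boost15-window : ∀ n → AllWindows (BoostWindow 15) n (boost15 n)
boost15-window n t _ i = bounded , dominated
  where
  e u v : ℕ
  e = boost15 n t i
  u = missing (pathPred t)
  v = missing (pathSucc n t)
  bounded : e ≤ 15
  bounded = ≤-trans (+-mono-≤ (+-monoʳ-≤ 3 (m∸n≤m 1 (present (pathPred t)))) (m∸n≤m 1 (present (pathSucc n t))))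
                    (m≤m+n 5 10)
  compensated : ∀ m → 3 ≤ 3 * missing m + entry (map (boost15 n) m) i
  compensated nothing  = ≤-refl
  compensated (just s) = m≤m+n 3 _
  dominated : 15 ≤ e + nbrSumᶜ id n (boost15 n) t i
  dominated = begin
    15
      ≤⟨ +-monoʳ-≤ 9 (+-mono-≤ (compensated (pathPred t)) (compensated (pathSucc n t))) ⟩
    9 + (3 * u + entry (above (boost15 n) t) i) + (3 * v + entry (below n (boost15 n) t) i)
      ≡⟨ solve 4 (λ u v a b → con 9 :+ (con 3 :* u :+ a) :+ (con 3 :* v :+ b) :=
                             (con 3 :+ u :+ v) :+ (a :+ b :+ ((con 3 :+ u :+ v) :+ (con 3 :+ u :+ v))))
               refl u v (entry (above (boost15 n) t) i) (entry (below n (boost15 n) t) i) ⟩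
    e + nbrSumᶜ id n (boost15 n) t i ∎
    where open ≤-Reasoning

columnsWeight-⊕ : ∀ n F G → columnsWeight n (F ⊕ G) ≡ columnsWeight n F + columnsWeight n G
columnsWeight-⊕ n F G =
  trans (sum-cong-≗ {n} λ j → ∑-distrib-+ {7} (F (toℕ j)) (G (toℕ j)))
        (∑-distrib-+ {n} (λ j → colSum (F (toℕ j))) (λ j → colSum (G (toℕ j))))

∑-const : ∀ n c → ∑[ j < n ] c ≡ n * c
∑-const zero    c = refl
∑-const (suc n) c = cong (c +_) (∑-const n c)

∑-missing-pathPred : ∀ n → ∑[ j < suc n ] missing (pathPred (toℕ j)) ≡ 1
∑-missing-pathPred n = cong suc (sum-replicate-zero n)

∑-missing-pathSucc : ∀ n → ∑[ j < suc n ] missing (pathSucc (suc n) (toℕ j)) ≡ 1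
∑-missing-pathSucc zero    = refl
∑-missing-pathSucc (suc n) =
  trans (sum-cong-≗ {suc n} λ j → cong (1 ∸_) (present-map suc (pathSucc (suc n) (toℕ j))))
        (∑-missing-pathSucc n)

columnsWeight-boost15 : ∀ n → columnsWeight (suc n) (boost15 (suc n)) ≡ 7 * (3 * suc n + 2)
columnsWeight-boost15 n = begin
  ∑[ j < suc n ] (7 * e j)
    ≡⟨ *-distribˡ-sum 7 e ⟨
  7 * ∑[ j < suc n ] (3 + u j + v j)
    ≡⟨ cong (7 *_) (trans (∑-distrib-+ {suc n} (λ j → 3 + u j) v)
                          (cong (_+ ∑[ j < suc n ] v j) (∑-distrib-+ {suc n} (λ _ → 3) u))) ⟩
  7 * (∑[ j < suc n ] 3 + ∑[ j < suc n ] u j + ∑[ j < suc n ] v j)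
    ≡⟨ cong (7 *_) (cong₂ _+_ (cong₂ _+_ (trans (∑-const (suc n) 3) (*-comm (suc n) 3)) (∑-missing-pathPred n))
                              (∑-missing-pathSucc n)) ⟩
  7 * (3 * suc n + 1 + 1)
    ≡⟨ cong (7 *_) (+-assoc (3 * suc n) 1 1) ⟩
  7 * (3 * suc n + 2) ∎
  where
  open ≡-Reasoning
  e u v : Fin (suc n) → ℕ
  e j = boost15 (suc n) (toℕ j) fzero
  u j = missing (pathPred (toℕ j))
  v j = missing (pathSucc (suc n) (toℕ j))

⌈+*⌉ : ∀ a q b .{{_ : NonZero b}} → ⌈ a + q * b / b ⌉ ≡ ⌈ a / b ⌉ + q
⌈+*⌉ a q (suc b) = begin
  (a + q * suc b + suc b ∸ 1) / suc b   ≡⟨ cong (λ x → (x ∸ 1) / suc b) (xy∙z≈xz∙y a (q * suc b) (suc b)) ⟩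
  (a + suc b + q * suc b ∸ 1) / suc b   ≡⟨ cong (_/ suc b) (+-∸-comm (q * suc b) 1≤a+suc-b) ⟩
  (a + suc b ∸ 1 + q * suc b) / suc b   ≡⟨ +-distrib-/-∣ʳ (a + suc b ∸ 1) (n∣m*n q) ⟩
  ⌈ a / suc b ⌉ + q * suc b / suc b     ≡⟨ cong (⌈ a / suc b ⌉ +_) (m*n/n≡m q (suc b)) ⟩
  ⌈ a / suc b ⌉ + q ∎
  where
  open ≡-Reasoning
  1≤a+suc-b : 1 ≤ a + suc b
  1≤a+suc-b = subst (1 ≤_) (sym (+-suc a b)) (s≤s z≤n)

α≤k+3 : ∀ k → α k ≤ k + 3
α≤k+3 k = ≤-pred (m<n*o⇒m/o<n (begin-strict
  k + 5 + 5 ∸ 1                  ≤⟨ m∸n≤m (k + 5 + 5) 1 ⟩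
  k + 5 + 5                      <⟨ m<m+n (k + 5 + 5) z<s ⟩
  k + 5 + 5 + suc (k * 4 + 9)    ≡⟨ solve 1 (λ k → k :+ con 5 :+ con 5 :+ (con 1 :+ (k :* con 4 :+ con 9)) :=
                                                   (con 1 :+ (k :+ con 3)) :* con 5) refl k ⟩
  suc (k + 3) * 5                ∎))
  where open ≤-Reasoning

α-+15 : ∀ k → α (k + 15) ≡ α k + 3
α-+15 k = trans (cong (λ x → ⌈ x / 5 ⌉) (trans (+-assoc k 15 5) (sym (+-assoc k 5 15)))) (⌈+*⌉ (k + 5) 3 5)

β-+15 : ∀ k → β (k + 15) ≡ β k + 4
β-+15 k = trans (cong (λ x → ⌈ x / 3 ⌉) numerator) (⌈+*⌉ (k + 3 ∸ α k) 4 3)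
  where
  open ≡-Reasoning
  numerator : k + 15 + 3 ∸ α (k + 15) ≡ k + 3 ∸ α k + 4 * 3
  numerator = begin
    k + 15 + 3 ∸ α (k + 15)   ≡⟨ cong₂ _∸_ (+-comm (k + 15) 3) (trans (α-+15 k) (+-comm (α k) 3)) ⟩
    3 + (k + 15) ∸ (3 + α k)  ≡⟨ [m+n]∸[m+o]≡n∸o 3 (k + 15) (α k) ⟩
    k + 15 ∸ α k              ≡⟨ cong (_∸ α k) (+-assoc k 3 12) ⟨
    k + 3 + 12 ∸ α k          ≡⟨ +-∸-comm 12 (α≤k+3 k) ⟩
    k + 3 ∸ α k + 4 * 3       ∎

bound-+15 : ∀ k n → bound (k + 15) (2 + n) ≡ bound k (2 + n) + 7 * (3 * (2 + n) + 2)
bound-+15 k n = begin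
  7 * n * α (k + 15) + 14 * β (k + 15)
    ≡⟨ cong₂ (λ a b → 7 * n * a + 14 * b) (α-+15 k) (β-+15 k) ⟩
  7 * n * (α k + 3) + 14 * (β k + 4)
    ≡⟨ solve 3 (λ n a b → con 7 :* n :* (a :+ con 3) :+ con 14 :* (b :+ con 4) :=
                         con 7 :* n :* a :+ con 14 :* b :+ con 7 :* (con 3 :* (con 2 :+ n) :+ con 2))
               refl n (α k) (β k) ⟩
  7 * n * α k + 14 * β k + 7 * (3 * (2 + n) + 2) ∎
  where open ≡-Reasoning

lift15 : ∀ {k n} → 2 ≤ n → Solution StrongWindow k n → Solution StrongWindow (k + 15) n
lift15 {k} {suc (suc n)} (s≤s (s≤s z≤n)) s = record
  { columns = columns ⊕ boost15 (2 + n)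
  ; windows = strong-⊕ windows (boost15-window (2 + n))
  ; light   = begin
      columnsWeight (2 + n) (columns ⊕ boost15 (2 + n)) + (2 + n + 2)
        ≡⟨ cong (_+ (2 + n + 2)) (trans (columnsWeight-⊕ (2 + n) columns (boost15 (2 + n)))
                                        (cong (W +_) (columnsWeight-boost15 (suc n)))) ⟩
      W + 7 * (3 * (2 + n) + 2) + (2 + n + 2)
        ≡⟨ xy∙z≈xz∙y W _ _ ⟩
      W + (2 + n + 2) + 7 * (3 * (2 + n) + 2)
        ≤⟨ +-monoˡ-≤ _ light ⟩
      bound k (2 + n) + 7 * (3 * (2 + n) + 2)
        ≡⟨ bound-+15 k n ⟨
      bound (k + 15) (2 + n) ∎
  }
  where
  open Solution s
  open ≤-Reasoning
  W : ℕ
  W = columnsWeight (2 + n) columns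

-- Lists of columns and periodic certificates

lastOr : Maybe Col → List Col → Maybe Col
lastOr a []       = a
lastOr a (c ∷ cs) = lastOr (just c) cs

Windows : WindowPredicate → Maybe Col → List Col → Maybe Col → Set
Windows W a []       b = ⊤
Windows W a (c ∷ cs) b = W a c (head cs <∣> b) × Windows W (just c) cs b

windows? : ∀ {W} → (∀ a c b → Dec (W a c b)) → ∀ a cs b → Dec (Windows W a cs b)
windows? W? a []       b = yes tt
windows? W? a (c ∷ cs) b = W? a c (head cs <∣> b) ×-dec windows? W? (just c) cs b

Windows-++ : ∀ {W} a xs ys b → Windows W a xs (head ys <∣> b) → Windows W (lastOr a xs) ys b →
             Windows W a (xs ++ ys) b
Windows-++     a []       ys b _          ys-windows = ys-windows
Windows-++ {W} a (x ∷ xs) ys b (wx , wxs) ys-windows =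
  subst (W a x) (head-++ xs) wx , Windows-++ (just x) xs ys b wxs ys-windows
  where
  head-++ : ∀ xs → head xs <∣> (head ys <∣> b) ≡ head (xs ++ ys) <∣> b
  head-++ []      = refl
  head-++ (_ ∷ _) = refl

columnAt : List Col → ℕ → Col
columnAt []       _       _ = 0
columnAt (c ∷ _)  zero      = c
columnAt (_ ∷ cs) (suc t)   = columnAt cs t

Windows-at : ∀ {W a b} cs {t} → Windows W a cs b → t < length cs →
             W (maybe′ (just ∘ columnAt cs) a (pathPred t)) (columnAt cs t)
               (maybe′ (just ∘ columnAt cs) b (pathSucc (length cs) t))
Windows-at (c ∷ [])     {zero}  (w , _) _ = w
Windows-at (c ∷ d ∷ cs) {zero}  (w , _) _ = w
Windows-at {W} {a} {b} (c ∷ cs) {suc t} (_ , ws) (s≤s t<n) =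
  subst₂ (λ x y → W x (columnAt cs t) y) (above-∷ t) (sym (maybe′-map _ b suc (pathSucc (length cs) t)))
         (Windows-at cs ws t<n)
  where
  above-∷ : ∀ t → maybe′ (just ∘ columnAt cs) (just c) (pathPred t) ≡ just (columnAt (c ∷ cs) t)
  above-∷ zero    = refl
  above-∷ (suc t) = refl

-- Definitional, as map F = maybe′ (just ∘ F) nothing.
Windows⇒AllWindows : ∀ {W} cs → Windows W nothing cs nothing → AllWindows W (length cs) (columnAt cs)
Windows⇒AllWindows cs windows t = Windows-at cs windows

listWeight : List Col → ℕ
listWeight cs = sumᴸ (List.map colSum cs)

columnsWeight-columnAt : ∀ cs → columnsWeight (length cs) (columnAt cs) ≡ listWeight cs
columnsWeight-columnAt []       = refl
columnsWeight-columnAt (c ∷ cs) = cong (colSum c +_) (columnsWeight-columnAt cs)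

listWeight-++ : ∀ xs ys → listWeight (xs ++ ys) ≡ listWeight xs + listWeight ys
listWeight-++ xs ys = trans (cong sumᴸ (map-++ colSum xs ys)) (sumᴸ-++ (List.map colSum xs) _)

Fits : (ℕ → WindowPredicate) → ℕ → List Col → Set
Fits W k cs = Windows (W k) nothing cs nothing × listWeight cs + (length cs + 2) ≤ bound k (length cs)

fits⇒solution : ∀ {W k} cs → Fits W k cs → Solution W k (length cs)
fits⇒solution {W} {k} cs (windows , light) = record
  { columns = columnAt cs
  ; windows = Windows⇒AllWindows cs windows
  ; light   = subst (λ x → x + (length cs + 2) ≤ bound k (length cs)) (sym (columnsWeight-columnAt cs)) light
  }

module Periodic (W : WindowPredicate) {p} (P : Fin (suc p) → Col) (R : Fin (suc p) → List Col) where

  mutual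
    block : Fin (suc p) → ℕ → List Col
    block ψ m = P ψ ∷ continuation ψ m

    continuation : Fin (suc p) → ℕ → List Col
    continuation ψ zero    = R ψ
    continuation ψ (suc m) = block (cycleSuc ψ) m

  block-windows : (∀ ψ → W (just (P ψ)) (P (cycleSuc ψ)) (just (P (cycleSuc (cycleSuc ψ))))) →
                  (∀ ψ → Windows W (just (P ψ)) (block (cycleSuc ψ) 0) nothing) →
                  ∀ ψ m → Windows W (just (P ψ)) (block (cycleSuc ψ) m) nothing
  block-windows inner last ψ zero    = last ψ
  block-windows inner last ψ (suc m) = inner ψ , block-windows inner last (cycleSuc ψ) m

  block-length : ∀ {w} → (∀ ψ → length (R ψ) ≡ w) → ∀ ψ m → length (block ψ m) ≡ suc (m + w)
  block-length R-length ψ zero    = cong suc (R-length ψ)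
  block-length R-length ψ (suc m) = cong suc (block-length R-length (cycleSuc ψ) m)

  block-weight : ∀ {s ω} (π : Fin (suc p) → ℕ) →
                 (∀ ψ → colSum (P ψ) + π (cycleSuc ψ) ≤ s + π ψ) → (∀ ψ → listWeight (R ψ) ≤ ω) →
                 ∀ ψ m → listWeight (block ψ m) ≤ suc m * s + π ψ + ω
  block-weight {s} {ω} π P-weight R-weight ψ zero = begin
    colSum (P ψ) + listWeight (R ψ)  ≤⟨ +-mono-≤ (≤-trans (m≤m+n _ _) (P-weight ψ)) (R-weight ψ) ⟩
    s + π ψ + ω                      ≡⟨ cong (λ x → x + π ψ + ω) (+-identityʳ s) ⟨
    1 * s + π ψ + ω                  ∎
    where open ≤-Reasoning
  block-weight {s} {ω} π P-weight R-weight ψ (suc m) = begin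
    colSum (P ψ) + listWeight (block (cycleSuc ψ) m)
      ≤⟨ +-monoʳ-≤ (colSum (P ψ)) (block-weight π P-weight R-weight (cycleSuc ψ) m) ⟩
    colSum (P ψ) + (suc m * s + π (cycleSuc ψ) + ω)
      ≡⟨ solve 4 (λ c m π ω → c :+ (m :+ π :+ ω) := c :+ π :+ m :+ ω)
               refl (colSum (P ψ)) (suc m * s) (π (cycleSuc ψ)) ω ⟩
    colSum (P ψ) + π (cycleSuc ψ) + suc m * s + ω
      ≤⟨ +-monoˡ-≤ ω (+-monoˡ-≤ (suc m * s) (P-weight ψ)) ⟩
    s + π ψ + suc m * s + ω
      ≡⟨ solve 4 (λ b π m ω → b :+ π :+ m :+ ω := b :+ m :+ π :+ ω) refl s (π ψ) (suc m * s) ω ⟩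
    suc (suc m) * s + π ψ + ω ∎
    where open ≤-Reasoning

bound-step : ∀ k N m → 2 ≤ N → bound k (N + m) ≡ bound k N + m * (7 * α k)
bound-step k (suc (suc N)) m (s≤s (s≤s z≤n)) =
  solve 4 (λ N m a b → con 7 :* (N :+ m) :* a :+ con 14 :* b := con 7 :* N :* a :+ con 14 :* b :+ m :* (con 7 :* a))
        refl N m (α k) (β k)

SmallFits : (ℕ → WindowPredicate) → ℕ → ℕ → List (List Col) → Set
SmallFits W k n []          = ⊤
SmallFits W k n (cs ∷ css) = (length cs ≡ n × Fits W k cs) × SmallFits W k (suc n) css

smallFits⇒solution : ∀ {W k n} css → SmallFits W k n css → ∀ m → n ≤ m → m < n + length css → Solution W k m
smallFits⇒solution {n = n} [] _ m n≤m m<n+0 = contradiction (subst (m <_) (+-identityʳ n) m<n+0) (≤⇒≯ n≤m)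
smallFits⇒solution {W} {k} {n} (cs ∷ css) ((refl , fits) , rest) m n≤m m<n+l with m ≟ n
... | yes refl = fits⇒solution cs fits
... | no m≢n   = smallFits⇒solution css rest m (≤∧≢⇒< n≤m (m≢n ∘ sym)) (subst (m <_) (+-suc n (length css)) m<n+l)

fits? : ∀ {W k} → (∀ a c b → Dec (W k a c b)) → ∀ cs → Dec (Fits W k cs)
fits? {k = k} W? cs = windows? W? nothing cs nothing ×-dec (listWeight cs + (length cs + 2) ≤? bound k (length cs))

smallFits? : ∀ {W k} → (∀ a c b → Dec (W k a c b)) → ∀ n css → Dec (SmallFits W k n css)
smallFits? W? n []         = yes tt
smallFits? {W} {k} W? n (cs ∷ css) = ((length cs ≟ n) ×-dec fits? {W} {k} W? cs) ×-dec smallFits? W? (suc n) css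

-- For n = N₀ + m the certified labelling is prefix ++ P φ₀ ∷ P φ₁ ∷ … ∷ P φₘ₊₁ ∷ R φₘ₊₁, where
-- φ₀ = 0 and φᵢ₊₁ = cycleSuc φᵢ; the potential π amortises the weights of the tile columns
-- against slope, and small lists labellings for n = 4, 5, … up to N₀ − 1.
record Certificate : Set where
  field
    prefix       : List Col
    period       : ℕ
    tile         : Vec Col (suc period)
    suffix       : Vec (List Col) (suc period)
    potential    : Vec ℕ (suc period)
    slope        : ℕ
    suffixLength : ℕ
    suffixWeight : ℕ
    small        : List (List Col)

  P : Fin (suc period) → Col
  P = lookup tile

  R : Fin (suc period) → List Col
  R = lookup suffix

  π : Fin (suc period) → ℕ
  π = lookup potential

  N₀ : ℕ
  N₀ = length prefix + 2 + suffixLength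

Valid : (ℕ → WindowPredicate) → ℕ → Certificate → Set
Valid W k c =
    Windows (W k) nothing prefix (just (P fzero))
  × W k (lastOr nothing prefix) (P fzero) (just (P (cycleSuc fzero)))
  × (∀ ψ → W k (just (P ψ)) (P (cycleSuc ψ)) (just (P (cycleSuc (cycleSuc ψ)))))
  × (∀ ψ → Windows (W k) (just (P ψ)) (P (cycleSuc ψ) ∷ R (cycleSuc ψ)) nothing)
  × (∀ ψ → length (R ψ) ≡ suffixLength)
  × (∀ ψ → colSum (P ψ) + π (cycleSuc ψ) ≤ slope + π ψ)
  × (∀ ψ → listWeight (R ψ) ≤ suffixWeight)
  × slope + 1 ≤ 7 * α k
  × listWeight prefix + π fzero + suffixWeight + 2 * slope + (N₀ + 2) ≤ bound k N₀
  × N₀ ≤ 4 + length small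
  × SmallFits W k 4 small
  where open Certificate c

valid? : ∀ {W} → (∀ k a c b → Dec (W k a c b)) → ∀ k c → Dec (Valid W k c)
valid? W? k c =
      windows? (W? k) nothing prefix (just (P fzero))
  ×-dec W? k (lastOr nothing prefix) (P fzero) (just (P (cycleSuc fzero)))
  ×-dec all? (λ ψ → W? k (just (P ψ)) (P (cycleSuc ψ)) (just (P (cycleSuc (cycleSuc ψ)))))
  ×-dec all? (λ ψ → windows? (W? k) (just (P ψ)) (P (cycleSuc ψ) ∷ R (cycleSuc ψ)) nothing)
  ×-dec all? (λ ψ → length (R ψ) ≟ suffixLength)
  ×-dec all? (λ ψ → colSum (P ψ) + π (cycleSuc ψ) ≤? slope + π ψ)
  ×-dec all? (λ ψ → listWeight (R ψ) ≤? suffixWeight)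
  ×-dec slope + 1 ≤? 7 * α k
  ×-dec listWeight prefix + π fzero + suffixWeight + 2 * slope + (N₀ + 2) ≤? bound k N₀
  ×-dec N₀ ≤? 4 + length small
  ×-dec smallFits? (W? k) 4 small
  where open Certificate c

certified : ∀ {W k} c → Valid W k c → ∀ n → 4 ≤ n → Solution W k n
certified {W} {k} c
  (prefix-ok , entry-ok , inner-ok , last-ok , R-length , P-weight , R-weight , slope-ok , base-ok , covered , small-ok)
  n 4≤n with n <? 4 + length (Certificate.small c)
... | yes n<4+l = smallFits⇒solution (Certificate.small c) small-ok n 4≤n n<4+l
... | no  n≮4+l = subst (Solution W k) (m+[n∸m]≡n (≤-trans covered (≮⇒≥ n≮4+l))) (familySolution (n ∸ N₀))
  where
  open Certificate c
  open Periodic (W k) P R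

  family : ℕ → List Col
  family m = prefix ++ block fzero (suc m)

  family-length : ∀ m → length (family m) ≡ N₀ + m
  family-length m =
    trans (length-++ prefix) (trans (cong (length prefix +_) (block-length R-length fzero (suc m)))
      (solve 3 (λ l m w → l :+ (con 2 :+ m :+ w) := l :+ con 2 :+ w :+ m) refl (length prefix) m suffixLength))

  2≤N₀ : 2 ≤ N₀
  2≤N₀ = ≤-trans (m≤n+m 2 (length prefix)) (m≤m+n _ suffixLength)

  family-light : ∀ m → listWeight (family m) + (N₀ + m + 2) ≤ bound k (N₀ + m)
  family-light m = begin
    listWeight (family m) + (N₀ + m + 2)
      ≡⟨ cong (_+ (N₀ + m + 2)) (listWeight-++ prefix (block fzero (suc m))) ⟩
    listWeight prefix + listWeight (block fzero (suc m)) + (N₀ + m + 2)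
      ≤⟨ +-monoˡ-≤ (N₀ + m + 2) (+-monoʳ-≤ (listWeight prefix) (block-weight π P-weight R-weight fzero (suc m))) ⟩
    listWeight prefix + (suc (suc m) * slope + π fzero + suffixWeight) + (N₀ + m + 2)
      ≡⟨ solve 6 (λ L m s p ω N → L :+ ((con 2 :+ m) :* s :+ p :+ ω) :+ (N :+ m :+ con 2) :=
                                  L :+ p :+ ω :+ con 2 :* s :+ (N :+ con 2) :+ m :* (s :+ con 1))
               refl (listWeight prefix) m slope (π fzero) suffixWeight N₀ ⟩
    listWeight prefix + π fzero + suffixWeight + 2 * slope + (N₀ + 2) + m * (slope + 1)
      ≤⟨ +-mono-≤ base-ok (*-monoʳ-≤ m slope-ok) ⟩
    bound k N₀ + m * (7 * α k)
      ≡⟨ bound-step k N₀ m 2≤N₀ ⟨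
    bound k (N₀ + m) ∎
    where open ≤-Reasoning

  family-fits : ∀ m → Fits W k (family m)
  family-fits m =
    Windows-++ nothing prefix (block fzero (suc m)) nothing
               prefix-ok (entry-ok , block-windows inner-ok last-ok fzero m) ,
    subst (λ N → listWeight (family m) + (N + 2) ≤ bound k N) (sym (family-length m)) (family-light m)

  familySolution : ∀ m → Solution W k (N₀ + m)
  familySolution m = subst (Solution W k) (family-length m) (fits⇒solution (family m) (family-fits m))

-- The certificates for 1 ≤ k ≤ 35

roman? : ∀ k a c b → Dec (RomanWindow k a c b)
roman? k a c b =
  all? λ i → c i ≤? suc k ×-dec (c i <? k →-dec k + nbrSumʷ sgn a c b i ≤? c i + nbrSumʷ id a c b i)

strong? : ∀ k a c b → Dec (StrongWindow k a c b)
strong? k a c b =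
  all? λ i → 1 ≤? c i ×-dec c i ≤? suc k ×-dec k + (present a + present b + 2) ≤? c i + nbrSumʷ id a c b i

col : ℕ → ℕ → ℕ → ℕ → ℕ → ℕ → ℕ → Col
col a b c d e f g = lookup (a ∷ b ∷ c ∷ d ∷ e ∷ f ∷ g ∷ [])

certificate₁ : Certificate
certificate₁ = record
  { prefix       = col 1 1 1 1 1 1 1 ∷ col 1 1 1 1 1 1 1 ∷ []
  ; period       = 2
  ; tile         = col 1 2 2 2 2 2 2 ∷ col 2 2 1 2 2 2 2 ∷ col 2 2 2 2 1 2 2 ∷ []
  ; suffix       = (col 1 1 1 1 1 1 1 ∷ col 1 1 1 1 1 1 1 ∷ [])
                 ∷ (col 1 1 1 1 1 1 1 ∷ col 1 1 1 1 1 1 1 ∷ [])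
                 ∷ (col 1 1 1 1 1 1 1 ∷ col 1 1 1 1 1 1 1 ∷ []) ∷ []
  ; potential    = 0 ∷ 0 ∷ 0 ∷ []
  ; slope        = 13
  ; suffixLength = 2
  ; suffixWeight = 14
  ; small        = (col 1 1 1 1 1 1 1 ∷ col 1 1 1 1 1 1 1 ∷ col 1 1 1 1 1 1 1 ∷ col 1 1 1 1 1 1 1 ∷ [])
                 ∷ (col 1 1 1 1 1 1 1 ∷ col 1 1 1 1 1 1 1 ∷ col 1 1 1 1 1 1 1 ∷ col 1 1 1 1 1 1 1 ∷
                    col 1 1 1 1 1 1 1 ∷ []) ∷ []
  }

certificate₂ : Certificate
certificate₂ = record
  { prefix       = col 1 1 2 1 1 2 1 ∷ col 2 1 1 1 1 1 1 ∷ []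
  ; period       = 2
  ; tile         = col 1 2 2 2 2 2 2 ∷ col 2 2 1 2 2 2 2 ∷ col 2 2 2 2 1 2 2 ∷ []
  ; suffix       = (col 1 1 1 1 1 2 1 ∷ col 2 1 1 2 1 1 1 ∷ [])
                 ∷ (col 1 2 1 1 1 1 1 ∷ col 1 1 1 2 1 1 2 ∷ [])
                 ∷ (col 1 1 1 2 1 1 1 ∷ col 1 2 1 1 1 2 1 ∷ []) ∷ []
  ; potential    = 0 ∷ 0 ∷ 0 ∷ []
  ; slope        = 13
  ; suffixLength = 2
  ; suffixWeight = 17
  ; small        = (col 1 1 2 1 1 2 1 ∷ col 2 1 1 1 1 1 1 ∷ col 1 1 1 2 2 1 1 ∷ col 1 2 1 1 1 1 2 ∷ [])
                 ∷ (col 1 1 1 2 1 1 2 ∷ col 1 2 1 1 1 1 1 ∷ col 1 1 1 1 2 2 2 ∷ col 1 1 2 1 1 1 1 ∷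
                    col 2 1 1 1 2 1 1 ∷ []) ∷ []
  }

certificate₃ : Certificate
certificate₃ = record
  { prefix       = col 2 1 2 1 2 2 1 ∷ col 2 1 2 1 1 1 1 ∷ []
  ; period       = 2
  ; tile         = col 1 2 2 2 2 2 2 ∷ col 2 2 1 2 2 2 2 ∷ col 2 2 2 2 1 2 2 ∷ []
  ; suffix       = (col 1 1 2 1 1 2 1 ∷ col 3 1 1 2 2 1 1 ∷ [])
                 ∷ (col 1 1 2 1 2 1 1 ∷ col 2 1 2 1 2 1 2 ∷ [])
                 ∷ (col 1 1 2 1 1 1 2 ∷ col 2 2 1 1 3 1 1 ∷ []) ∷ []
  ; potential    = 0 ∷ 0 ∷ 0 ∷ []
  ; slope        = 13
  ; suffixLength = 2
  ; suffixWeight = 20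
  ; small        = (col 2 1 2 1 2 2 1 ∷ col 2 1 2 1 1 2 1 ∷ col 1 1 1 2 1 2 2 ∷ col 1 3 1 2 1 2 1 ∷ [])
                 ∷ (col 1 2 1 2 1 2 2 ∷ col 1 2 1 2 1 1 2 ∷ col 1 1 2 1 2 1 2 ∷ col 2 1 2 1 2 1 1 ∷
                    col 2 1 2 1 2 2 1 ∷ []) ∷ []
  }

certificate₄ : Certificate
certificate₄ = record
  { prefix       = col 3 1 2 2 2 2 1 ∷ col 2 1 2 1 1 2 1 ∷ []
  ; period       = 2
  ; tile         = col 1 2 2 2 2 2 2 ∷ col 2 2 1 2 2 2 2 ∷ col 2 2 2 2 1 2 2 ∷ []
  ; suffix       = (col 2 1 2 1 1 2 1 ∷ col 3 1 2 2 2 2 1 ∷ [])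
                 ∷ (col 2 1 2 1 2 1 1 ∷ col 2 1 3 1 2 2 2 ∷ [])
                 ∷ (col 1 1 2 1 2 1 2 ∷ col 2 2 2 1 3 1 2 ∷ []) ∷ []
  ; potential    = 0 ∷ 0 ∷ 0 ∷ []
  ; slope        = 13
  ; suffixLength = 2
  ; suffixWeight = 23
  ; small        = (col 2 2 1 3 2 1 2 ∷ col 1 2 2 1 1 2 2 ∷ col 2 1 2 1 2 2 1 ∷ col 3 1 2 2 2 1 2 ∷ [])
                 ∷ (col 3 1 2 2 2 2 1 ∷ col 3 1 2 1 1 2 1 ∷ col 2 1 2 2 2 2 1 ∷ col 1 2 1 1 2 1 2 ∷
                    col 1 3 2 2 2 1 3 ∷ []) ∷ []
  }

certificate₅ : Certificate
certificate₅ = record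
  { prefix       = col 2 3 0 4 0 3 3 ∷ col 3 2 0 3 2 0 0 ∷ []
  ; period       = 1
  ; tile         = col 0 0 3 0 3 3 2 ∷ col 3 3 3 2 2 0 2 ∷ []
  ; suffix       = (col 3 2 0 3 2 0 0 ∷ col 2 3 0 4 0 3 3 ∷ [])
                 ∷ (col 2 0 0 2 3 2 3 ∷ col 0 3 3 0 3 1 3 ∷ []) ∷ []
  ; potential    = 0 ∷ 2 ∷ []
  ; slope        = 13
  ; suffixLength = 2
  ; suffixWeight = 25
  ; small        = (col 0 0 0 0 6 0 6 ∷ col 0 6 6 0 0 0 0 ∷ col 0 0 0 0 0 6 0 ∷ col 6 0 0 6 0 0 0 ∷ [])
                 ∷ (col 5 0 0 5 0 2 0 ∷ col 0 2 3 0 0 4 0 ∷ col 0 2 3 0 5 0 3 ∷ col 3 0 0 5 0 0 3 ∷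
                    col 0 4 2 0 0 6 0 ∷ []) ∷ []
  }

certificate₆ : Certificate
certificate₆ = record
  { prefix       = col 2 3 2 2 3 3 2 ∷ col 2 2 2 2 1 1 2 ∷ []
  ; period       = 2
  ; tile         = col 2 3 3 3 3 3 3 ∷ col 3 3 2 3 3 3 3 ∷ col 3 3 3 3 2 3 3 ∷ []
  ; suffix       = (col 2 1 3 1 1 2 2 ∷ col 4 2 2 2 4 2 1 ∷ [])
                 ∷ (col 3 1 1 2 2 1 1 ∷ col 2 2 4 2 2 3 3 ∷ [])
                 ∷ (col 1 1 3 1 2 1 2 ∷ col 3 2 3 1 4 2 3 ∷ []) ∷ []
  ; potential    = 0 ∷ 0 ∷ 0 ∷ []
  ; slope        = 20
  ; suffixLength = 2
  ; suffixWeight = 29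
  ; small        = (col 3 3 2 2 3 3 1 ∷ col 2 1 2 2 2 2 2 ∷ col 2 2 3 2 1 2 3 ∷ col 3 3 1 2 4 2 1 ∷ [])
                 ∷ (col 2 3 3 1 3 3 2 ∷ col 3 1 2 3 2 1 2 ∷ col 3 1 2 3 1 3 2 ∷ col 1 3 3 2 1 3 1 ∷
                    col 3 2 1 3 3 2 3 ∷ []) ∷ []
  }

certificate₇ : Certificate
certificate₇ = record
  { prefix       = col 3 3 2 3 3 3 2 ∷ col 2 2 2 2 1 2 2 ∷ []
  ; period       = 2
  ; tile         = col 2 3 3 3 3 3 3 ∷ col 3 3 2 3 3 3 3 ∷ col 3 3 3 3 2 3 3 ∷ []
  ; suffix       = (col 2 2 2 1 2 2 2 ∷ col 3 2 3 3 3 2 3 ∷ [])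
                 ∷ (col 3 1 3 1 2 2 1 ∷ col 4 1 4 2 3 3 2 ∷ [])
                 ∷ (col 1 1 3 1 3 1 3 ∷ col 3 3 3 1 5 1 3 ∷ []) ∷ []
  ; potential    = 0 ∷ 0 ∷ 0 ∷ []
  ; slope        = 20
  ; suffixLength = 2
  ; suffixWeight = 32
  ; small        = (col 2 3 3 2 1 5 2 ∷ col 3 2 2 4 2 2 1 ∷ col 3 2 2 1 2 2 3 ∷ col 2 2 4 2 4 2 3 ∷ [])
                 ∷ (col 3 2 4 1 3 4 2 ∷ col 3 1 3 2 2 2 1 ∷ col 3 3 2 3 2 2 3 ∷ col 1 2 2 3 2 2 2 ∷
                    col 3 3 2 3 2 3 3 ∷ []) ∷ []
  }

certificate₈ : Certificate
certificate₈ = record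
  { prefix       = col 4 2 4 2 3 4 2 ∷ col 3 1 3 2 2 2 2 ∷ []
  ; period       = 2
  ; tile         = col 2 3 3 3 3 3 3 ∷ col 3 3 2 3 3 3 3 ∷ col 3 3 3 3 2 3 3 ∷ []
  ; suffix       = (col 1 2 3 1 3 2 3 ∷ col 4 3 3 2 5 1 3 ∷ [])
                 ∷ (col 1 3 2 3 2 2 2 ∷ col 3 3 2 4 2 3 4 ∷ [])
                 ∷ (col 1 2 3 1 3 1 4 ∷ col 3 3 3 2 5 1 4 ∷ []) ∷ []
  ; potential    = 0 ∷ 0 ∷ 0 ∷ []
  ; slope        = 20
  ; suffixLength = 2
  ; suffixWeight = 36
  ; small        = (col 2 3 4 3 2 5 2 ∷ col 4 2 1 3 2 2 2 ∷ col 2 2 2 3 3 1 3 ∷ col 1 4 4 1 3 4 4 ∷ [])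
                 ∷ (col 3 3 3 3 4 2 3 ∷ col 2 2 2 2 2 2 3 ∷ col 2 3 3 3 3 3 2 ∷ col 3 2 2 1 3 2 2 ∷
                    col 3 2 4 3 3 3 3 ∷ []) ∷ []
  }

certificate₉ : Certificate
certificate₉ = record
  { prefix       = col 4 3 3 3 4 3 3 ∷ col 2 2 3 2 2 2 3 ∷ []
  ; period       = 2
  ; tile         = col 2 3 3 3 3 3 3 ∷ col 3 3 2 3 3 3 3 ∷ col 3 3 3 3 2 3 3 ∷ []
  ; suffix       = (col 2 2 3 2 2 2 3 ∷ col 4 3 3 3 4 3 3 ∷ [])
                 ∷ (col 2 2 3 2 3 1 3 ∷ col 3 3 4 2 4 3 4 ∷ [])
                 ∷ (col 1 3 2 2 3 2 3 ∷ col 3 4 3 3 4 2 4 ∷ []) ∷ []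
  ; potential    = 0 ∷ 0 ∷ 0 ∷ []
  ; slope        = 20
  ; suffixLength = 2
  ; suffixWeight = 39
  ; small        = (col 0 10 0 0 10 0 0 ∷ col 0 0 0 0 0 0 10 ∷ col 0 0 10 10 0 0 0 ∷ col 10 0 0 0 0 10 0 ∷ [])
                 ∷ (col 5 5 0 0 10 0 0 ∷ col 0 0 6 0 5 0 6 ∷ col 0 0 5 0 6 0 6 ∷ col 5 6 0 0 1 4 0 ∷
                    col 5 0 0 10 0 6 0 ∷ []) ∷ []
  }

certificate₁₀ : Certificate
certificate₁₀ = record
  { prefix       = col 4 3 3 4 4 3 3 ∷ col 3 3 3 2 2 3 3 ∷ []
  ; period       = 2
  ; tile         = col 2 3 3 3 3 3 3 ∷ col 3 3 2 3 3 3 3 ∷ col 3 3 3 3 2 3 3 ∷ []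
  ; suffix       = (col 3 3 3 2 3 2 3 ∷ col 3 3 4 3 4 3 4 ∷ [])
                 ∷ (col 3 3 3 3 2 3 2 ∷ col 4 3 3 4 3 4 3 ∷ [])
                 ∷ (col 2 3 3 3 3 3 2 ∷ col 4 3 3 4 3 3 4 ∷ []) ∷ []
  ; potential    = 0 ∷ 0 ∷ 0 ∷ []
  ; slope        = 20
  ; suffixLength = 2
  ; suffixWeight = 43
  ; small        = (col 1 5 4 2 3 5 4 ∷ col 3 3 2 4 3 1 3 ∷ col 4 1 3 3 3 2 3 ∷ col 3 4 5 1 4 5 2 ∷ [])
                 ∷ (col 4 4 4 3 3 5 2 ∷ col 3 2 2 4 2 3 2 ∷ col 3 4 2 4 2 2 4 ∷ col 1 3 2 3 4 3 3 ∷
                    col 4 5 4 2 4 3 3 ∷ []) ∷ []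
  }

certificate₁₁ : Certificate
certificate₁₁ = record
  { prefix       = col 5 3 4 4 4 4 3 ∷ col 3 2 3 2 2 3 2 ∷ []
  ; period       = 2
  ; tile         = col 3 4 4 4 4 4 4 ∷ col 4 4 3 4 4 4 4 ∷ col 4 4 4 4 3 4 4 ∷ []
  ; suffix       = (col 3 2 3 2 2 3 2 ∷ col 5 3 4 4 4 4 3 ∷ [])
                 ∷ (col 3 2 3 2 3 2 2 ∷ col 4 3 5 3 4 4 4 ∷ [])
                 ∷ (col 2 2 3 2 3 2 3 ∷ col 4 4 4 3 5 3 4 ∷ []) ∷ []
  ; potential    = 0 ∷ 0 ∷ 0 ∷ []
  ; slope        = 27
  ; suffixLength = 2
  ; suffixWeight = 44
  ; small        = (col 3 4 3 5 2 4 5 ∷ col 2 4 2 4 3 3 2 ∷ col 4 3 2 3 3 3 3 ∷ col 3 4 5 3 3 5 3 ∷ [])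
                 ∷ (col 4 3 4 4 5 1 5 ∷ col 2 3 3 1 4 3 4 ∷ col 2 4 4 4 3 3 3 ∷ col 4 2 3 3 1 4 3 ∷
                    col 5 4 3 4 4 5 1 ∷ []) ∷ []
  }

certificate₁₂ : Certificate
certificate₁₂ = record
  { prefix       = col 6 3 3 6 3 5 3 ∷ col 3 3 3 3 1 5 1 ∷ []
  ; period       = 2
  ; tile         = col 3 4 4 4 4 4 4 ∷ col 4 4 3 4 4 4 4 ∷ col 4 4 4 4 3 4 4 ∷ []
  ; suffix       = (col 2 3 3 2 3 2 4 ∷ col 4 4 4 4 5 3 5 ∷ [])
                 ∷ (col 4 2 4 1 5 1 2 ∷ col 4 2 7 2 5 4 5 ∷ [])
                 ∷ (col 1 3 3 2 4 1 5 ∷ col 3 5 4 3 6 2 6 ∷ []) ∷ []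
  ; potential    = 0 ∷ 0 ∷ 0 ∷ []
  ; slope        = 27
  ; suffixLength = 2
  ; suffixWeight = 48
  ; small        = (col 4 4 4 4 4 4 4 ∷ col 3 3 3 3 3 3 3 ∷ col 3 3 3 3 3 3 3 ∷ col 4 4 4 4 4 4 4 ∷ [])
                 ∷ (col 4 4 4 6 2 5 4 ∷ col 3 4 1 3 2 4 2 ∷ col 3 4 4 4 5 3 3 ∷ col 3 1 5 1 2 3 5 ∷
                    col 4 5 5 4 6 3 3 ∷ []) ∷ []
  }

certificate₁₃ : Certificate
certificate₁₃ = record
  { prefix       = col 6 4 3 6 4 5 4 ∷ col 2 4 3 3 1 5 2 ∷ []
  ; period       = 2
  ; tile         = col 3 4 4 4 4 4 4 ∷ col 4 4 3 4 4 4 4 ∷ col 4 4 4 4 3 4 4 ∷ []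
  ; suffix       = (col 5 2 3 3 2 5 2 ∷ col 6 3 5 5 3 6 2 ∷ [])
                 ∷ (col 3 3 4 2 4 2 3 ∷ col 4 4 6 3 5 4 5 ∷ [])
                 ∷ (col 3 2 4 3 4 2 3 ∷ col 5 4 5 3 5 4 5 ∷ []) ∷ []
  ; potential    = 0 ∷ 0 ∷ 0 ∷ []
  ; slope        = 27
  ; suffixLength = 2
  ; suffixWeight = 52
  ; small        = (col 5 4 3 6 4 3 5 ∷ col 2 4 3 3 3 4 3 ∷ col 3 4 4 2 3 4 3 ∷ col 6 3 4 5 5 3 4 ∷ [])
                 ∷ (col 2 5 6 4 3 5 6 ∷ col 4 3 1 3 4 2 3 ∷ col 5 4 4 5 5 3 4 ∷ col 4 2 3 2 3 3 2 ∷
                    col 4 4 6 4 4 6 4 ∷ []) ∷ []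
  }

certificate₁₄ : Certificate
certificate₁₄ = record
  { prefix       = col 6 4 5 5 5 4 4 ∷ col 3 3 4 2 3 4 3 ∷ []
  ; period       = 2
  ; tile         = col 3 4 4 4 4 4 4 ∷ col 4 4 3 4 4 4 4 ∷ col 4 4 4 4 3 4 4 ∷ []
  ; suffix       = (col 3 3 4 3 3 4 3 ∷ col 6 4 4 5 5 4 4 ∷ [])
                 ∷ (col 4 3 4 3 3 3 3 ∷ col 5 4 5 4 5 5 4 ∷ [])
                 ∷ (col 3 3 4 3 4 3 3 ∷ col 5 4 5 4 5 4 5 ∷ []) ∷ []
  ; potential    = 0 ∷ 0 ∷ 0 ∷ []
  ; slope        = 27
  ; suffixLength = 2
  ; suffixWeight = 55
  ; small        = (col 6 4 4 5 5 4 4 ∷ col 3 3 6 3 3 4 3 ∷ col 3 2 5 2 3 4 4 ∷ col 6 5 4 5 6 3 4 ∷ [])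
                 ∷ (col 5 5 4 4 6 3 5 ∷ col 3 3 4 3 4 3 4 ∷ col 4 3 4 4 3 4 5 ∷ col 3 4 4 4 3 4 2 ∷
                    col 6 4 3 6 4 5 4 ∷ []) ∷ []
  }

certificate₁₅ : Certificate
certificate₁₅ = record
  { prefix       = col 5 5 4 5 6 5 4 ∷ col 4 4 4 3 3 3 4 ∷ []
  ; period       = 2
  ; tile         = col 3 4 4 4 4 4 4 ∷ col 4 4 3 4 4 4 4 ∷ col 4 4 4 4 3 4 4 ∷ []
  ; suffix       = (col 4 4 3 3 4 3 4 ∷ col 4 5 5 5 5 5 5 ∷ [])
                 ∷ (col 4 5 4 4 3 4 3 ∷ col 5 4 4 6 4 5 5 ∷ [])
                 ∷ (col 3 3 4 4 4 4 4 ∷ col 5 5 5 4 5 5 5 ∷ []) ∷ []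
  ; potential    = 0 ∷ 0 ∷ 0 ∷ []
  ; slope        = 27
  ; suffixLength = 2
  ; suffixWeight = 60
  ; small        = (col 9 1 5 7 5 2 5 ∷ col 3 4 5 1 4 6 2 ∷ col 1 6 4 2 3 5 4 ∷ col 6 4 2 9 5 1 7 ∷ [])
                 ∷ (col 5 7 2 6 5 5 5 ∷ col 2 4 4 5 2 3 4 ∷ col 5 3 4 2 5 5 5 ∷ col 5 3 6 3 5 2 1 ∷
                    col 5 2 8 3 4 6 6 ∷ []) ∷ []
  }

certificate₁₆ : Certificate
certificate₁₆ = record
  { prefix       = col 6 5 5 6 5 6 4 ∷ col 4 3 3 4 2 4 3 ∷ []
  ; period       = 2
  ; tile         = col 4 5 5 5 5 5 5 ∷ col 5 5 4 5 5 5 5 ∷ col 5 5 5 5 4 5 5 ∷ []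
  ; suffix       = (col 3 3 4 3 3 3 4 ∷ col 6 5 5 5 6 5 5 ∷ [])
                 ∷ (col 3 3 4 3 4 2 4 ∷ col 5 5 6 4 6 5 6 ∷ [])
                 ∷ (col 3 2 5 2 4 3 4 ∷ col 6 5 6 4 7 4 5 ∷ []) ∷ []
  ; potential    = 0 ∷ 0 ∷ 0 ∷ []
  ; slope        = 34
  ; suffixLength = 2
  ; suffixWeight = 60
  ; small        = (col 5 6 5 4 6 5 5 ∷ col 4 3 4 4 4 3 4 ∷ col 4 3 4 4 3 4 4 ∷ col 5 6 5 5 5 6 4 ∷ [])
                 ∷ (col 6 5 6 5 6 4 5 ∷ col 3 2 5 2 4 4 4 ∷ col 5 5 5 4 5 4 4 ∷ col 4 4 2 5 3 4 3 ∷
                    col 4 6 5 6 3 7 5 ∷ []) ∷ []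
  }

certificate₁₇ : Certificate
certificate₁₇ = record
  { prefix       = col 8 4 6 5 6 6 4 ∷ col 5 2 5 3 3 5 2 ∷ []
  ; period       = 2
  ; tile         = col 4 5 5 5 5 5 5 ∷ col 5 5 4 5 5 5 5 ∷ col 5 5 5 5 4 5 5 ∷ []
  ; suffix       = (col 6 2 6 2 5 3 2 ∷ col 7 2 9 3 6 6 5 ∷ [])
                 ∷ (col 3 3 5 3 5 3 4 ∷ col 6 5 6 4 7 4 6 ∷ [])
                 ∷ (col 4 3 5 3 4 4 3 ∷ col 7 4 6 5 6 5 5 ∷ []) ∷ []
  ; potential    = 0 ∷ 0 ∷ 0 ∷ []
  ; slope        = 34
  ; suffixLength = 2
  ; suffixWeight = 64
  ; small        = (col 4 7 6 3 7 6 5 ∷ col 5 3 4 5 4 2 5 ∷ col 5 2 4 5 3 4 4 ∷ col 5 7 6 4 5 8 3 ∷ [])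
                 ∷ (col 6 6 4 6 5 6 5 ∷ col 4 5 4 5 3 4 3 ∷ col 5 4 3 5 4 5 5 ∷ col 3 4 5 4 4 3 4 ∷
                    col 6 5 5 5 6 5 6 ∷ []) ∷ []
  }

certificate₁₈ : Certificate
certificate₁₈ = record
  { prefix       = col 7 5 6 6 5 7 4 ∷ col 5 3 4 4 3 5 3 ∷ []
  ; period       = 2
  ; tile         = col 4 5 5 5 5 5 5 ∷ col 5 5 4 5 5 5 5 ∷ col 5 5 5 5 4 5 5 ∷ []
  ; suffix       = (col 4 4 4 4 3 4 4 ∷ col 6 6 5 6 6 6 5 ∷ [])
                 ∷ (col 4 4 4 3 5 3 4 ∷ col 5 5 7 5 6 5 7 ∷ [])
                 ∷ (col 4 4 3 4 5 3 5 ∷ col 4 7 6 5 6 5 7 ∷ []) ∷ []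
  ; potential    = 0 ∷ 0 ∷ 0 ∷ []
  ; slope        = 34
  ; suffixLength = 2
  ; suffixWeight = 68
  ; small        = (col 6 5 5 7 4 5 7 ∷ col 3 5 4 5 5 5 3 ∷ col 5 5 3 4 3 4 5 ∷ col 5 5 6 7 6 5 6 ∷ [])
                 ∷ (col 6 6 6 4 8 4 6 ∷ col 3 3 5 3 5 4 5 ∷ col 5 5 5 5 5 4 5 ∷ col 4 4 3 4 4 4 4 ∷
                    col 5 6 6 6 5 6 6 ∷ []) ∷ []
  }

certificate₁₉ : Certificate
certificate₁₉ = record
  { prefix       = col 7 6 6 6 6 6 6 ∷ col 4 4 4 4 4 4 4 ∷ []
  ; period       = 2
  ; tile         = col 4 5 5 5 5 5 5 ∷ col 5 5 4 5 5 5 5 ∷ col 5 5 5 5 4 5 5 ∷ []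
  ; suffix       = (col 4 4 5 3 5 4 4 ∷ col 7 5 6 6 7 5 6 ∷ [])
                 ∷ (col 4 5 4 5 3 4 4 ∷ col 5 7 5 6 6 7 6 ∷ [])
                 ∷ (col 5 3 5 4 5 4 3 ∷ col 7 5 7 5 6 6 6 ∷ []) ∷ []
  ; potential    = 0 ∷ 0 ∷ 0 ∷ []
  ; slope        = 34
  ; suffixLength = 2
  ; suffixWeight = 71
  ; small        = (col 8 8 2 6 11 3 4 ∷ col 2 4 7 3 2 4 7 ∷ col 2 2 7 5 3 7 6 ∷ col 11 8 2 5 10 4 1 ∷ [])
                 ∷ (col 6 6 6 6 6 6 6 ∷ col 4 4 4 4 4 4 4 ∷ col 5 5 5 5 5 5 5 ∷ col 4 4 4 4 4 4 4 ∷
                    col 6 6 6 6 6 6 6 ∷ []) ∷ []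
  }

certificate₂₀ : Certificate
certificate₂₀ = record
  { prefix       = col 0 5 16 0 0 14 7 ∷ col 12 0 0 6 8 0 0 ∷ col 9 6 0 8 8 0 4 ∷ col 0 8 10 0 0 11 10 ∷ []
  ; period       = 2
  ; tile         = col 8 0 4 8 6 0 4 ∷ col 10 4 0 6 8 5 0 ∷ col 0 8 10 0 0 9 10 ∷ []
  ; suffix       = (col 10 5 0 5 8 5 0 ∷ col 0 7 11 6 0 9 6 ∷ col 0 0 10 0 0 9 7 ∷ col 15 6 0 7 14 0 0 ∷ [])
                 ∷ (col 0 8 10 0 0 9 8 ∷ col 7 0 4 8 7 0 7 ∷ col 10 5 0 8 7 0 0 ∷ col 0 7 14 0 0 15 6 ∷ [])
                 ∷ (col 0 0 5 11 6 0 11 ∷ col 11 10 0 0 11 0 0 ∷ col 0 3 9 0 10 11 0 ∷ col 10 0 10 11 1 0 11 ∷ []) ∷ []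
  ; potential    = 0 ∷ 2 ∷ 3 ∷ []
  ; slope        = 34
  ; suffixLength = 4
  ; suffixWeight = 141
  ; small        = (col 0 0 13 8 0 5 16 ∷ col 6 9 0 0 12 0 0 ∷ col 7 7 0 4 9 6 0 ∷ col 4 0 12 9 0 7 11 ∷ [])
                 ∷ (col 0 13 0 9 0 13 5 ∷ col 6 9 0 13 0 4 4 ∷ col 4 9 0 0 9 4 5 ∷ col 0 0 13 0 9 3 7 ∷
                    col 13 0 9 0 13 0 8 ∷ [])
                 ∷ (col 14 0 5 16 0 0 7 ∷ col 0 9 0 0 6 15 0 ∷ col 0 12 9 0 0 11 0 ∷ col 10 0 0 13 9 0 11 ∷
                    col 11 0 0 13 0 0 0 ∷ col 0 11 10 0 0 21 0 ∷ [])
                 ∷ (col 11 0 11 11 0 11 0 ∷ col 12 0 0 0 0 10 0 ∷ col 0 10 11 11 12 0 0 ∷ col 0 0 0 0 0 0 21 ∷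
                    col 0 12 11 11 10 0 0 ∷ col 10 0 0 0 0 12 0 ∷ col 11 0 11 11 0 11 0 ∷ [])
                 ∷ (col 7 0 9 8 5 0 14 ∷ col 0 7 6 0 9 8 0 ∷ col 9 9 0 0 9 5 0 ∷ col 4 0 8 13 0 0 9 ∷
                    col 0 14 0 0 0 11 10 ∷ col 4 7 0 10 11 0 0 ∷ col 12 0 7 5 0 0 9 ∷ col 0 10 11 0 8 13 0 ∷ [])
                 ∷ (col 14 0 4 7 11 0 7 ∷ col 0 7 12 0 4 7 0 ∷ col 2 3 0 9 0 11 9 ∷ col 9 12 0 12 0 0 0 ∷
                    col 0 4 0 0 10 11 5 ∷ col 6 6 18 0 0 0 6 ∷ col 5 1 0 4 12 7 6 ∷ col 7 11 0 7 2 2 0 ∷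
                    col 0 7 5 10 0 12 9 ∷ []) ∷ []
  }

certificate₂₁ : Certificate
certificate₂₁ = record
  { prefix       = col 8 6 7 7 6 7 6 ∷ col 5 4 4 4 4 5 3 ∷ []
  ; period       = 2
  ; tile         = col 5 6 6 6 6 6 6 ∷ col 6 6 5 6 6 6 6 ∷ col 6 6 6 6 5 6 6 ∷ []
  ; suffix       = (col 5 3 6 3 4 5 4 ∷ col 9 5 7 6 8 6 5 ∷ [])
                 ∷ (col 5 4 5 4 4 4 4 ∷ col 7 6 7 6 7 7 6 ∷ [])
                 ∷ (col 4 4 5 4 4 4 5 ∷ col 7 7 6 6 8 6 6 ∷ []) ∷ []
  ; potential    = 0 ∷ 0 ∷ 0 ∷ []
  ; slope        = 41
  ; suffixLength = 2
  ; suffixWeight = 76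
  ; small        = (col 7 5 7 7 5 7 7 ∷ col 5 5 5 5 5 5 3 ∷ col 5 5 3 5 5 5 5 ∷ col 5 7 7 7 5 7 7 ∷ [])
                 ∷ (col 6 6 7 7 7 6 7 ∷ col 5 5 4 4 4 4 5 ∷ col 5 5 5 6 6 6 4 ∷ col 6 5 5 4 3 5 5 ∷
                    col 7 6 6 7 7 7 5 ∷ []) ∷ []
  }

certificate₂₂ : Certificate
certificate₂₂ = record
  { prefix       = col 8 6 7 7 7 7 6 ∷ col 5 4 5 4 4 5 4 ∷ []
  ; period       = 2
  ; tile         = col 5 6 6 6 6 6 6 ∷ col 6 6 5 6 6 6 6 ∷ col 6 6 6 6 5 6 6 ∷ []
  ; suffix       = (col 5 4 5 4 4 5 4 ∷ col 8 6 7 7 7 7 6 ∷ [])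
                 ∷ (col 5 4 5 4 5 4 4 ∷ col 7 6 8 6 7 7 7 ∷ [])
                 ∷ (col 4 4 5 4 5 4 5 ∷ col 7 7 7 6 8 6 7 ∷ []) ∷ []
  ; potential    = 0 ∷ 0 ∷ 0 ∷ []
  ; slope        = 41
  ; suffixLength = 2
  ; suffixWeight = 79
  ; small        = (col 9 7 5 11 7 3 7 ∷ col 3 5 6 2 4 8 6 ∷ col 4 6 8 3 6 5 3 ∷ col 10 3 6 8 8 4 8 ∷ [])
                 ∷ (col 6 7 7 7 9 3 9 ∷ col 3 5 4 3 6 4 7 ∷ col 5 7 7 6 4 6 4 ∷ col 7 2 3 6 4 8 4 ∷
                    col 8 7 8 7 4 10 3 ∷ []) ∷ []
  }

certificate₂₃ : Certificate
certificate₂₃ = record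
  { prefix       = col 8 7 7 7 7 8 6 ∷ col 5 4 5 5 4 5 5 ∷ []
  ; period       = 2
  ; tile         = col 5 6 6 6 6 6 6 ∷ col 6 6 5 6 6 6 6 ∷ col 6 6 6 6 5 6 6 ∷ []
  ; suffix       = (col 5 6 4 5 5 5 5 ∷ col 6 7 7 8 6 7 8 ∷ [])
                 ∷ (col 5 5 5 4 5 5 4 ∷ col 7 6 8 7 7 7 8 ∷ [])
                 ∷ (col 6 4 7 4 7 4 3 ∷ col 8 4 10 5 7 7 8 ∷ []) ∷ []
  ; potential    = 0 ∷ 0 ∷ 0 ∷ []
  ; slope        = 41
  ; suffixLength = 2
  ; suffixWeight = 84
  ; small        = (col 7 7 7 7 7 7 7 ∷ col 5 5 5 5 5 5 5 ∷ col 5 5 5 5 5 5 5 ∷ col 7 7 7 7 7 7 7 ∷ [])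
                 ∷ (col 2 10 7 4 9 8 9 ∷ col 5 7 5 6 5 1 7 ∷ col 6 5 4 7 7 6 6 ∷ col 6 5 6 4 3 7 2 ∷
                    col 8 5 8 7 7 9 7 ∷ []) ∷ []
  }

certificate₂₄ : Certificate
certificate₂₄ = record
  { prefix       = col 8 7 8 7 8 7 8 ∷ col 5 5 5 4 6 4 5 ∷ []
  ; period       = 2
  ; tile         = col 5 6 6 6 6 6 6 ∷ col 6 6 5 6 6 6 6 ∷ col 6 6 6 6 5 6 6 ∷ []
  ; suffix       = (col 5 6 5 4 5 6 5 ∷ col 8 6 7 9 7 6 8 ∷ [])
                 ∷ (col 6 5 6 5 4 6 4 ∷ col 9 6 7 8 7 8 6 ∷ [])
                 ∷ (col 5 4 6 5 5 5 5 ∷ col 8 8 7 7 8 7 7 ∷ []) ∷ []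
  ; potential    = 0 ∷ 0 ∷ 0 ∷ []
  ; slope        = 41
  ; suffixLength = 2
  ; suffixWeight = 87
  ; small        = (col 8 10 4 7 10 9 3 ∷ col 6 5 7 6 2 5 7 ∷ col 3 4 6 6 5 5 7 ∷ col 8 10 5 6 10 6 6 ∷ [])
                 ∷ (col 6 8 7 10 4 9 8 ∷ col 6 6 2 6 5 6 4 ∷ col 6 7 7 5 7 4 6 ∷ col 3 3 7 3 8 5 8 ∷
                    col 8 8 8 5 11 3 8 ∷ []) ∷ []
  }

certificate₂₅ : Certificate
certificate₂₅ = record
  { prefix       = col 8 8 7 7 9 8 6 ∷ col 6 6 6 5 5 5 6 ∷ []
  ; period       = 2
  ; tile         = col 5 6 6 6 6 6 6 ∷ col 6 6 5 6 6 6 6 ∷ col 6 6 6 6 5 6 6 ∷ []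
  ; suffix       = (col 7 6 5 5 6 5 6 ∷ col 6 7 9 7 7 8 8 ∷ [])
                 ∷ (col 6 6 7 6 5 5 5 ∷ col 8 7 7 7 8 8 7 ∷ [])
                 ∷ (col 5 5 7 6 6 6 5 ∷ col 9 7 7 7 8 7 7 ∷ []) ∷ []
  ; potential    = 0 ∷ 0 ∷ 0 ∷ []
  ; slope        = 41
  ; suffixLength = 2
  ; suffixWeight = 92
  ; small        = (col 7 10 7 6 9 9 5 ∷ col 6 4 5 7 5 5 7 ∷ col 6 4 6 6 5 4 6 ∷ col 7 9 8 5 9 9 6 ∷ [])
                 ∷ (col 7 8 9 5 11 6 8 ∷ col 5 4 6 4 6 3 7 ∷ col 6 7 6 8 6 7 6 ∷ col 5 6 6 5 2 7 4 ∷
                    col 8 8 6 8 9 9 7 ∷ []) ∷ []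
  }

certificate₂₆ : Certificate
certificate₂₆ = record
  { prefix       = col 8 6 10 7 10 7 9 ∷ col 6 5 6 2 8 3 5 ∷ []
  ; period       = 2
  ; tile         = col 6 7 7 7 7 7 7 ∷ col 7 7 6 7 7 7 7 ∷ col 7 7 7 7 6 7 7 ∷ []
  ; suffix       = (col 6 5 5 6 3 6 5 ∷ col 9 8 7 9 8 9 6 ∷ [])
                 ∷ (col 4 6 5 6 5 3 7 ∷ col 6 10 7 7 9 8 9 ∷ [])
                 ∷ (col 4 5 6 4 7 4 6 ∷ col 8 8 8 7 10 6 9 ∷ []) ∷ []
  ; potential    = 0 ∷ 0 ∷ 0 ∷ []
  ; slope        = 48
  ; suffixLength = 2
  ; suffixWeight = 92
  ; small        = (col 7 4 10 12 3 8 12 ∷ col 6 9 3 4 9 6 2 ∷ col 6 8 4 4 8 5 4 ∷ col 6 4 11 10 4 7 13 ∷ [])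
                 ∷ (col 8 7 8 9 8 7 9 ∷ col 5 6 5 4 6 5 5 ∷ col 6 7 7 6 7 7 7 ∷ col 5 5 5 6 4 6 5 ∷
                    col 9 8 7 9 7 9 7 ∷ []) ∷ []
  }

certificate₂₇ : Certificate
certificate₂₇ = record
  { prefix       = col 9 8 8 8 9 8 8 ∷ col 5 5 6 5 5 5 6 ∷ []
  ; period       = 2
  ; tile         = col 6 7 7 7 7 7 7 ∷ col 7 7 6 7 7 7 7 ∷ col 7 7 7 7 6 7 7 ∷ []
  ; suffix       = (col 6 5 5 6 4 6 5 ∷ col 9 8 8 9 8 9 7 ∷ [])
                 ∷ (col 5 5 6 5 6 4 6 ∷ col 8 8 9 7 9 8 9 ∷ [])
                 ∷ (col 5 5 5 6 5 5 6 ∷ col 8 9 8 8 9 8 8 ∷ []) ∷ []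
  ; potential    = 0 ∷ 0 ∷ 0 ∷ []
  ; slope        = 48
  ; suffixLength = 2
  ; suffixWeight = 95
  ; small        = (col 9 8 8 8 9 7 8 ∷ col 5 6 6 5 6 6 6 ∷ col 5 6 6 6 5 6 6 ∷ col 9 8 7 9 8 8 8 ∷ [])
                 ∷ (col 8 8 9 8 8 9 8 ∷ col 6 5 5 6 5 5 5 ∷ col 7 7 6 7 7 7 7 ∷ col 4 6 6 5 6 5 6 ∷
                    col 8 9 8 8 9 7 9 ∷ []) ∷ []
  }

certificate₂₈ : Certificate
certificate₂₈ = record
  { prefix       = col 9 8 9 9 8 10 7 ∷ col 7 5 5 7 4 6 5 ∷ []
  ; period       = 2
  ; tile         = col 6 7 7 7 7 7 7 ∷ col 7 7 6 7 7 7 7 ∷ col 7 7 7 7 6 7 7 ∷ []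
  ; suffix       = (col 5 5 7 5 6 6 6 ∷ col 10 8 8 8 10 7 8 ∷ [])
                 ∷ (col 7 5 7 5 5 6 5 ∷ col 10 7 9 8 9 9 7 ∷ [])
                 ∷ (col 4 6 6 5 6 5 7 ∷ col 8 9 8 8 10 7 10 ∷ []) ∷ []
  ; potential    = 0 ∷ 0 ∷ 0 ∷ []
  ; slope        = 48
  ; suffixLength = 2
  ; suffixWeight = 99
  ; small        = (col 10 8 8 9 9 7 8 ∷ col 5 6 6 6 6 7 6 ∷ col 5 7 6 5 6 6 6 ∷ col 9 8 8 9 9 7 9 ∷ [])
                 ∷ (col 10 9 6 10 9 7 9 ∷ col 5 6 6 6 5 6 5 ∷ col 6 7 8 6 6 9 7 ∷ col 7 5 6 6 6 4 5 ∷
                    col 9 10 7 8 10 8 9 ∷ []) ∷ []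
  }

certificate₂₉ : Certificate
certificate₂₉ = record
  { prefix       = col 9 9 8 9 9 9 8 ∷ col 6 6 6 6 5 6 6 ∷ []
  ; period       = 2
  ; tile         = col 6 7 7 7 7 7 7 ∷ col 7 7 6 7 7 7 7 ∷ col 7 7 7 7 6 7 7 ∷ []
  ; suffix       = (col 6 6 6 5 6 6 6 ∷ col 9 8 9 9 9 8 9 ∷ [])
                 ∷ (col 6 6 6 6 6 6 5 ∷ col 9 8 9 9 8 9 9 ∷ [])
                 ∷ (col 5 6 6 6 6 6 6 ∷ col 9 9 8 9 9 8 9 ∷ []) ∷ []
  ; potential    = 0 ∷ 0 ∷ 0 ∷ []
  ; slope        = 48
  ; suffixLength = 2
  ; suffixWeight = 102
  ; small        = (col 9 10 7 8 9 11 6 ∷ col 7 6 7 8 4 6 7 ∷ col 7 3 7 6 7 5 7 ∷ col 9 10 10 5 11 9 7 ∷ [])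
                 ∷ (col 8 9 8 10 7 9 10 ∷ col 5 7 5 7 6 6 5 ∷ col 8 7 7 7 7 7 7 ∷ col 6 5 7 5 6 6 6 ∷
                    col 10 8 9 8 10 8 8 ∷ []) ∷ []
  }

certificate₃₀ : Certificate
certificate₃₀ = record
  { prefix       = col 9 8 9 9 10 8 9 ∷ col 7 7 7 6 6 6 7 ∷ []
  ; period       = 2
  ; tile         = col 6 7 7 7 7 7 7 ∷ col 7 7 6 7 7 7 7 ∷ col 7 7 7 7 6 7 7 ∷ []
  ; suffix       = (col 7 7 6 6 7 6 7 ∷ col 8 8 10 9 9 8 10 ∷ [])
                 ∷ (col 7 7 7 7 6 6 6 ∷ col 9 8 9 9 8 10 9 ∷ [])
                 ∷ (col 6 6 7 7 7 7 6 ∷ col 10 9 8 9 9 8 9 ∷ []) ∷ []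
  ; potential    = 0 ∷ 0 ∷ 0 ∷ []
  ; slope        = 48
  ; suffixLength = 2
  ; suffixWeight = 108
  ; small        = (col 4 10 13 5 8 11 11 ∷ col 8 6 5 7 9 4 7 ∷ col 9 6 4 8 6 6 4 ∷ col 7 9 11 9 5 14 8 ∷ [])
                 ∷ (col 9 10 9 8 9 10 9 ∷ col 6 5 6 7 6 5 7 ∷ col 8 7 7 7 7 8 7 ∷ col 6 7 8 6 6 7 4 ∷
                    col 11 6 9 10 8 9 10 ∷ []) ∷ []
  }

certificate₃₁ : Certificate
certificate₃₁ = record
  { prefix       = col 11 9 8 10 10 10 9 ∷ col 5 6 7 6 4 7 6 ∷ []
  ; period       = 2
  ; tile         = col 7 8 8 8 8 8 8 ∷ col 8 8 7 8 8 8 8 ∷ col 8 8 8 8 7 8 8 ∷ []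
  ; suffix       = (col 5 8 5 4 8 5 8 ∷ col 7 9 10 10 10 6 13 ∷ [])
                 ∷ (col 7 6 7 5 6 7 4 ∷ col 10 7 11 9 9 10 10 ∷ [])
                 ∷ (col 6 6 7 5 6 7 5 ∷ col 10 8 10 9 10 9 10 ∷ []) ∷ []
  ; potential    = 0 ∷ 0 ∷ 0 ∷ []
  ; slope        = 55
  ; suffixLength = 2
  ; suffixWeight = 108
  ; small        = (col 10 8 13 7 9 10 8 ∷ col 8 4 6 6 8 7 6 ∷ col 7 9 6 8 7 4 6 ∷ col 5 10 10 8 8 11 12 ∷ [])
                 ∷ (col 9 10 9 9 9 11 8 ∷ col 7 6 6 7 5 6 6 ∷ col 7 8 7 8 8 7 8 ∷ col 5 7 6 6 7 6 7 ∷
                    col 9 10 9 9 10 8 10 ∷ []) ∷ []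
  }

certificate₃₂ : Certificate
certificate₃₂ = record
  { prefix       = col 11 7 12 8 10 10 9 ∷ col 8 5 8 5 7 6 5 ∷ []
  ; period       = 2
  ; tile         = col 7 8 8 8 8 8 8 ∷ col 8 8 7 8 8 8 8 ∷ col 8 8 8 8 7 8 8 ∷ []
  ; suffix       = (col 8 5 6 7 5 8 5 ∷ col 11 9 10 10 8 12 7 ∷ [])
                 ∷ (col 8 5 8 5 6 7 5 ∷ col 12 7 11 9 10 10 8 ∷ [])
                 ∷ (col 5 7 6 5 8 5 8 ∷ col 8 10 10 9 11 7 12 ∷ []) ∷ []
  ; potential    = 0 ∷ 0 ∷ 0 ∷ []
  ; slope        = 55
  ; suffixLength = 2
  ; suffixWeight = 111
  ; small        = (col 7 11 9 12 5 13 10 ∷ col 9 9 3 9 5 7 5 ∷ col 8 6 6 7 10 7 5 ∷ col 8 7 14 8 7 10 12 ∷ [])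
                 ∷ (col 9 10 10 9 10 9 11 ∷ col 5 7 6 6 7 5 7 ∷ col 8 8 7 8 8 8 8 ∷ col 7 6 7 7 5 7 6 ∷
                    col 10 10 9 9 10 11 8 ∷ []) ∷ []
  }

certificate₃₃ : Certificate
certificate₃₃ = record
  { prefix       = col 11 9 10 10 10 10 9 ∷ col 7 6 7 6 6 7 6 ∷ []
  ; period       = 2
  ; tile         = col 7 8 8 8 8 8 8 ∷ col 8 8 7 8 8 8 8 ∷ col 8 8 8 8 7 8 8 ∷ []
  ; suffix       = (col 7 6 7 6 6 7 6 ∷ col 11 9 10 10 10 10 9 ∷ [])
                 ∷ (col 7 6 7 6 7 6 6 ∷ col 10 9 11 9 10 10 10 ∷ [])
                 ∷ (col 6 6 7 6 7 6 7 ∷ col 10 10 10 9 11 9 10 ∷ []) ∷ []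
  ; potential    = 0 ∷ 0 ∷ 0 ∷ []
  ; slope        = 55
  ; suffixLength = 2
  ; suffixWeight = 114
  ; small        = (col 10 7 12 10 8 10 11 ∷ col 8 8 7 6 8 7 5 ∷ col 6 8 6 6 8 7 7 ∷ col 9 9 10 11 9 8 12 ∷ [])
                 ∷ (col 11 11 8 11 10 9 10 ∷ col 4 9 6 8 6 7 6 ∷ col 7 8 7 8 7 9 10 ∷ col 8 6 8 7 7 6 5 ∷
                    col 11 9 12 7 10 12 8 ∷ []) ∷ []
  }

certificate₃₄ : Certificate
certificate₃₄ = record
  { prefix       = col 9 12 9 10 11 10 10 ∷ col 7 7 7 7 6 6 8 ∷ []
  ; period       = 2
  ; tile         = col 7 8 8 8 8 8 8 ∷ col 8 8 7 8 8 8 8 ∷ col 8 8 8 8 7 8 8 ∷ []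
  ; suffix       = (col 7 7 6 6 7 8 8 ∷ col 9 10 11 11 9 10 11 ∷ [])
                 ∷ (col 7 7 7 7 6 7 6 ∷ col 10 10 10 10 10 11 10 ∷ [])
                 ∷ (col 6 8 7 7 8 7 6 ∷ col 10 9 10 11 9 9 12 ∷ []) ∷ []
  ; potential    = 0 ∷ 0 ∷ 0 ∷ []
  ; slope        = 55
  ; suffixLength = 2
  ; suffixWeight = 120
  ; small        = (col 10 10 10 10 10 10 10 ∷ col 7 7 7 7 7 7 7 ∷ col 7 7 7 7 7 7 7 ∷ col 10 10 10 10 10 10 10 ∷ [])
                 ∷ (col 10 9 10 12 8 11 11 ∷ col 7 8 6 7 7 7 5 ∷ col 8 9 8 7 9 8 9 ∷ col 5 6 8 7 7 5 8 ∷
                    col 11 10 10 9 11 10 11 ∷ []) ∷ []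
  }

certificate₃₅ : Certificate
certificate₃₅ = record
  { prefix       = col 10 11 11 10 10 11 10 ∷ col 7 7 6 7 7 7 7 ∷ col 8 8 8 9 8 7 9 ∷ []
  ; period       = 2
  ; tile         = col 7 8 8 8 8 8 8 ∷ col 8 8 7 8 8 8 8 ∷ col 8 8 8 8 7 8 8 ∷ []
  ; suffix       = (col 9 8 8 7 9 7 8 ∷ col 7 6 8 7 8 7 7 ∷ col 11 10 11 9 11 10 10 ∷ [])
                 ∷ (col 8 8 8 9 7 8 9 ∷ col 6 7 7 7 7 7 7 ∷ col 11 11 10 10 11 10 10 ∷ [])
                 ∷ (col 8 8 8 8 8 9 7 ∷ col 8 7 7 7 7 7 7 ∷ col 10 10 11 10 10 11 10 ∷ []) ∷ []
  ; potential    = 0 ∷ 0 ∷ 0 ∷ []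
  ; slope        = 55
  ; suffixLength = 3
  ; suffixWeight = 178
  ; small        = (col 9 11 11 9 11 10 11 ∷ col 7 7 7 7 8 6 8 ∷ col 8 7 7 8 7 7 7 ∷ col 10 11 10 10 10 12 9 ∷ [])
                 ∷ (col 10 11 10 11 11 10 11 ∷ col 6 8 6 6 7 6 7 ∷ col 8 8 9 9 9 9 9 ∷ col 8 6 8 6 6 7 6 ∷
                    col 12 9 11 10 11 11 9 ∷ [])
                 ∷ (col 11 9 10 11 10 10 11 ∷ col 7 8 8 7 7 7 6 ∷ col 7 10 6 8 8 9 8 ∷ col 8 8 7 10 7 7 9 ∷
                    col 7 6 8 7 7 7 7 ∷ col 11 11 11 8 12 11 9 ∷ [])
                 ∷ (col 10 12 9 11 10 10 11 ∷ col 6 7 6 8 8 7 7 ∷ col 9 8 9 7 9 7 8 ∷ col 8 6 10 6 8 8 8 ∷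
                    col 9 8 8 8 9 8 7 ∷ col 7 8 5 8 6 7 7 ∷ col 9 11 10 12 9 11 11 ∷ []) ∷ []
  }

roman-certificates : Vec Certificate 20
roman-certificates =
  certificate₁ ∷ certificate₂ ∷ certificate₃ ∷ certificate₄ ∷ certificate₅ ∷ certificate₆ ∷ certificate₇ ∷
  certificate₈ ∷ certificate₉ ∷ certificate₁₀ ∷ certificate₁₁ ∷ certificate₁₂ ∷ certificate₁₃ ∷ certificate₁₄ ∷
  certificate₁₅ ∷ certificate₁₆ ∷ certificate₁₇ ∷ certificate₁₈ ∷ certificate₁₉ ∷ certificate₂₀ ∷ []

strong-certificates : Vec Certificate 15
strong-certificates =
  certificate₂₁ ∷ certificate₂₂ ∷ certificate₂₃ ∷ certificate₂₄ ∷ certificate₂₅ ∷ certificate₂₆ ∷ certificate₂₇ ∷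
  certificate₂₈ ∷ certificate₂₉ ∷ certificate₃₀ ∷ certificate₃₁ ∷ certificate₃₂ ∷ certificate₃₃ ∷ certificate₃₄ ∷
  certificate₃₅ ∷ []

roman-certificates-valid : ∀ r → Valid RomanWindow (1 + toℕ r) (lookup roman-certificates r)
roman-certificates-valid = from-yes (all? λ r → valid? roman? (1 + toℕ r) (lookup roman-certificates r))

strong-certificates-valid : ∀ r → Valid StrongWindow (21 + toℕ r) (lookup strong-certificates r)
strong-certificates-valid = from-yes (all? λ r → valid? strong? (21 + toℕ r) (lookup strong-certificates r))

table-solution : ∀ {W lo c} (certificates : Vec Certificate c) →
                 (∀ r → Valid W (lo + toℕ r) (lookup certificates r)) →
                 ∀ k → lo ≤ k → k < lo + c → ∀ n → 4 ≤ n → Solution W k n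
table-solution {W} {lo} {c} certificates valid k lo≤k k<lo+c n 4≤n =
  subst (λ k → Solution W k n) (trans (cong (lo +_) (toℕ-fromℕ< k∸lo<c)) (m+[n∸m]≡n lo≤k))
        (certified (lookup certificates r) (valid r) n 4≤n)
  where
  k∸lo<c : k ∸ lo < c
  k∸lo<c = subst (k ∸ lo <_) (m+n∸m≡n lo c) (∸-monoˡ-< k<lo+c lo≤k)
  r : Fin c
  r = fromℕ< k∸lo<c

strong-solution : ∀ k → 21 ≤ k → ∀ n → 4 ≤ n → Solution StrongWindow k n
strong-solution = <-rec _ step
  where
  step : ∀ k → (∀ {j} → j < k → 21 ≤ j → ∀ n → 4 ≤ n → Solution StrongWindow j n) →
         21 ≤ k → ∀ n → 4 ≤ n → Solution StrongWindow k n
  step k smaller 21≤k n 4≤n with k <? 36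
  ... | yes k<36 = table-solution strong-certificates strong-certificates-valid k 21≤k k<36 n 4≤n
  ... | no  k≮36 = subst (λ k → Solution StrongWindow k n) (m∸n+n≡m 15≤k)
                         (lift15 (≤-trans (m≤m+n 2 2) 4≤n)
                                 (smaller (∸-monoʳ-< z<s 15≤k) (∸-monoˡ-≤ 15 (≮⇒≥ k≮36)) n 4≤n))
    where
    15≤k : 15 ≤ k
    15≤k = ≤-trans (m≤m+n 15 6) 21≤k

strong⇒roman-solution : ∀ {k n} → Solution StrongWindow k n → Solution RomanWindow k n
strong⇒roman-solution s = record { columns = columns ; windows = strong⇒roman windows ; light = light }
  where open Solution s

roman-solution : ∀ k n → 1 ≤ k → 4 ≤ n → Solution RomanWindow k n
roman-solution k n 1≤k 4≤n with k <? 21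
... | yes k<21 = table-solution roman-certificates roman-certificates-valid k 1≤k k<21 n 4≤n
... | no  k≮21 = strong⇒roman-solution (strong-solution k (≮⇒≥ k≮21) n 4≤n)

theorem17 : (n k : ℕ) → 4 ≤ n → 1 ≤ k →
    γ[ k ]R-C 7 □P n ≤ ((7 * (n ∸ 2) * ⌈ k + 5 / 5 ⌉ + 14 * ⌈ k + 3 ∸ ⌈ k + 5 / 5 ⌉ / 3 ⌉) ∸ (n + 2))
theorem17 n k 4≤n 1≤k = solution⇒γ≤ (roman-solution k n 1≤k 4≤n)
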